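{- Let $G$ be a set and let $k,\ell\ge 1$ be integers. For every $\vec r=(r_1,\dots,r_k)\in\mathbb Z_{\ge1}^k$, $\vec a\in G^k$, $\vec s=(s_1,\dots,s_\ell)\in\mathbb Z_{\ge1}^\ell$, $\vec b\in G^\ell$, the following identity holds in $(\mathcal H(\mathbb Z_{\ge1}\times G),\sqcup\!\sqcup_\rho)$: $$\binom{\vec r}{\vec a}\sqcup\!\sqcup_\rho\binom{\vec s}{\vec b}=\sum_{(\varphi,\psi)\in I_{k,\ell}}\ \sum_{\substack{\vec t\in\mathbb Z_{\ge1}^{k+\ell}\\ |\vec t|=|\vec r|+|\vec s|}} c_{\vec r,\vec s}^{\vec t,(\varphi,\psi)}\binom{\vec t}{\vec a\sqcup\!\sqcup_{(\varphi,\psi)}\vec b}.$$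
   Context: Words and the algebra: for a set $G$, an element of the free monoid on $\mathbb Z_{\ge1}\times G$ is written $\binom{s_1,\dots,s_k}{b_1,\dots,b_k}=\binom{\vec s}{\vec b}$ (the word $(s_1,b_1)\cdots(s_k,b_k)$); the empty word is $1$. $\mathcal H(\mathbb Z_{\ge1}\times G)$ is the free abelian group with these words as basis. Let $x_0$ and $x_b$ ($b\in G$) be pairwise distinct letters (indexed by the disjoint union $\{0\}\sqcup G$), and let $\sqcup\!\sqcup$ be the shuffle product on the free abelian group on words in these letters, defined by $1\sqcup\!\sqcup w=w\sqcup\!\sqcup 1=w$ and $(a_1u)\sqcup\!\sqcup(b_1v)=a_1(u\sqcup\!\sqcup b_1v)+b_1(a_1u\sqcup\!\sqcup v)$ for letters $a_1,b_1$ and words $u,v$. The span $\mathcal H_1$ of $1$ and of the words ending in some $x_b$, $b\in G$, is closed under $\sqcup\!\sqcup$, and the words $x_0^{s_1-1}x_{b_1}\cdots x_0^{s_k-1}x_{b_k}$ ($s_i\ge1$, $b_i\in G$, $k\ge1$) together with $1$ form a basis of it. Let $\rho:\mathcal H_1\to\mathcal H(\mathbb Z_{\ge1}\times G)$ be the linear bijection $x_0^{s_1-1}x_{b_1}\cdots x_0^{s_k-1}x_{b_k}\mapsto\binom{s_1,\dots,s_k}{b_1,\dots,b_k}$, $1\mapsto 1$, and define $u\sqcup\!\sqcup_\rho v=\rho(\rho^{ -1}(u)\sqcup\!\sqcup\rho^{ -1}(v))$. Coefficients: $[k]=\{1,\dots,k\}$. $I_{k,\ell}$ is the set of pairs $(\varphi,\psi)$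 of order-preserving injective maps $\varphi:[k]\to[k+\ell]$, $\psi:[\ell]\to[k+\ell]$ with $\mathrm{im}\,\varphi\sqcup\mathrm{im}\,\psi=[k+\ell]$. For $\vec a\in G^k,\vec b\in G^\ell$, $\vec a\sqcup\!\sqcup_{(\varphi,\psi)}\vec b\in G^{k+\ell}$ has $i$-th entry $a_j$ if $i=\varphi(j)$ and $b_j$ if $i=\psi(j)$. $|\vec x|$ denotes the sum of the entries. For $\vec t\in\mathbb Z_{\ge1}^{k+\ell}$ with $|\vec t|=|\vec r|+|\vec s|$ and $(\varphi,\psi)\in I_{k,\ell}$, put $h_i=r_j$ if $i=\varphi(j)$ and $h_i=s_j$ if $i=\psi(j)$, and $\varepsilon(i)=1$ if $i\in\mathrm{im}\,\varphi$, $\varepsilon(i)=-1$ if $i\in\mathrm{im}\,\psi$. Define $c(i)=\binom{t_i-1}{h_i-1}$ if $i=1$ or if $i\ge2$ and $\varepsilon(i)=\varepsilon(i-1)$; and $c(i)=\binom{t_i-1}{\sum_{j=1}^i t_j-\sum_{j=1}^i h_j}$ if $i\ge2$ and $\varepsilon(i)\ne\varepsilon(i-1)$. Here for integers $a\ge0$ and $b$, $\binom{a}{b}$ is the usual binomial coefficient if $0\le b\le a$ and $0$ otherwise. Finally $c_{\vec r,\vec s}^{\vec t,(\varphi,\psi)}=\prod_{i=1}^{k+\ell}c(i)$. -}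

module Defs where

open import Data.Nat using (ℕ; zero; suc; _+_; _∸_; _<ᵇ_; _≡ᵇ_)
open import Data.Nat.Combinatorics using (_C_)
open import Data.Integer as ℤ using (ℤ; +_; -[1+_])
open import Data.Bool using (Bool; true; false; if_then_else_; _∧_; _xor_; not)
open import Data.Maybe using (Maybe; just; nothing; is-just)
open import Data.Product using (_×_; _,_)
open import Data.Fin using (Fin; toℕ)
open import Data.Fin.Properties using (_≟_)
open import Relation.Nullary.Decidable using (⌊_⌋)
open import Data.List as List using (List; []; _∷_; _++_; map; concatMap; replicate; upTo; allFin; take; filter)
open import Data.Nat.ListAction using (sum; product)
open import Data.Vec as Vec using (Vec)
open import Relation.Binary.PropositionalEquality using (_≡_)

at : ∀ {A : Set} → A → List A → ℕ → A
at d []       _       = d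
at d (x ∷ xs) zero    = x
at d (x ∷ xs) (suc i) = at d xs i

allVecs : ∀ {A : Set} → List A → (n : ℕ) → List (Vec A n)
allVecs xs zero    = Vec.[] ∷ []
allVecs xs (suc n) = concatMap (λ x → map (x Vec.∷_) (allVecs xs n)) xs

allB : ∀ {A : Set} → (A → Bool) → List A → Bool
allB p []       = true
allB p (y ∷ ys) = p y ∧ allB p ys

sequenceMaybe : ∀ {A : Set} → List (Maybe A) → Maybe (List A)
sequenceMaybe []              = just []
sequenceMaybe (nothing ∷ _)   = nothing
sequenceMaybe (just x ∷ xs) with sequenceMaybe xs
... | just ys = just (x ∷ ys)
... | nothing = nothing

-- Free abelian group on a set X: finite formal ℤ-linear combinations.
-- Two formal sums are equal in the free abelian group iff they have the
-- same image under the linear extension of every function X → ℤ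
-- (i.e. they have the same coefficient on every basis element).

FreeAb : Set → Set
FreeAb X = List (ℤ × X)

evalLin : ∀ {X : Set} → (X → ℤ) → FreeAb X → ℤ
evalLin f []            = + 0
evalLin f ((c , x) ∷ L) = c ℤ.* f x ℤ.+ evalLin f L

infix 4 _≈_
_≈_ : ∀ {X : Set} → FreeAb X → FreeAb X → Set
L ≈ M = ∀ (f : _ → ℤ) → evalLin f L ≡ evalLin f M

basis : ∀ {X : Set} → X → FreeAb X
basis x = (+ 1 , x) ∷ []

data Letter (G : Set) : Set where
  x₀ : Letter G
  x  : G → Letter G

-- u ⧢ v as the list of words occurring (each with coefficient 1)
_⧢_ : ∀ {A : Set} → List A → List A → List (List A)
[]      ⧢ v       = v ∷ []
(a ∷ u) ⧢ []      = (a ∷ u) ∷ []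
(a ∷ u) ⧢ (b ∷ v) = map (a ∷_) (u ⧢ (b ∷ v)) ++ map (b ∷_) ((a ∷ u) ⧢ v)

-- Words in ℤ_{≥1} × G: the word (s₁,b₁)⋯(s_k,b_k) is the list of pairs.

IWord : Set → Set
IWord G = List (ℕ × G)

ρ⁻¹ : ∀ {G : Set} → IWord G → List (Letter G)
ρ⁻¹ []            = []
ρ⁻¹ ((s , b) ∷ w) = replicate (s ∸ 1) x₀ ++ (x b ∷ ρ⁻¹ w)

-- ρ on the basis of 𝓗₁: read off blocks x₀^{s-1} x_b ; n counts the x₀'s
-- seen so far in the current block.  (Only applied to words of 𝓗₁,
-- for which no trailing x₀'s occur.)
ρ-go : ∀ {G : Set} → ℕ → List (Letter G) → IWord G
ρ-go n []        = []
ρ-go n (x₀ ∷ w)  = ρ-go (suc n) w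
ρ-go n (x b ∷ w) = (suc n , b) ∷ ρ-go 0 w

ρ : ∀ {G : Set} → List (Letter G) → IWord G
ρ = ρ-go 0

_⧢ρ_ : ∀ {G : Set} → FreeAb (IWord G) → FreeAb (IWord G) → FreeAb (IWord G)
L ⧢ρ M = concatMap (λ { (c , u) → concatMap (λ { (d , v) →
           map (λ w → (c ℤ.* d , ρ w)) (ρ⁻¹ u ⧢ ρ⁻¹ v) }) M }) L

word : ∀ {G : Set} {k : ℕ} → Vec ℕ k → Vec G k → IWord G
word r a = Vec.toList (Vec.zip r a)

-- A map [k] → [n] is given by its vector of values (0-based Fin n).

-- order-preserving and injective  =  strictly increasing
strictlyIncreasing : ∀ {n k : ℕ} → Vec (Fin n) k → Bool
strictlyIncreasing Vec.[]                   = true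
strictlyIncreasing (i Vec.∷ Vec.[])         = true
strictlyIncreasing (i Vec.∷ (j Vec.∷ v))    =
  (toℕ i <ᵇ toℕ j) ∧ strictlyIncreasing (j Vec.∷ v)

preimage : ∀ {n k : ℕ} → Vec (Fin n) k → Fin n → Maybe (Fin k)
preimage Vec.[]       i = nothing
preimage (j Vec.∷ v) i with ⌊ j ≟ i ⌋ | preimage v i
... | true  | _       = just Fin.zero
... | false | just m  = just (Fin.suc m)
... | false | nothing = nothing

inImage : ∀ {n k : ℕ} → Vec (Fin n) k → Fin n → Bool
inImage φ i = is-just (preimage φ i)

isShufflePair : ∀ {k ℓ : ℕ} → Vec (Fin (k + ℓ)) k → Vec (Fin (k + ℓ)) ℓ → Bool
isShufflePair {k} {ℓ} φ ψ =
  strictlyIncreasing φ ∧ strictlyIncreasing ψ ∧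
  allB (λ i → inImage φ i xor inImage ψ i) (allFin (k + ℓ))

I : (k ℓ : ℕ) → List (Vec (Fin (k + ℓ)) k × Vec (Fin (k + ℓ)) ℓ)
I k ℓ = filter (λ p → isShufflePair (Data.Product.proj₁ p) (Data.Product.proj₂ p) Data.Bool.≟ true)
          (concatMap (λ φ → map (φ ,_) (allVecs (allFin (k + ℓ)) ℓ))
                     (allVecs (allFin (k + ℓ)) k))
  where import Data.Product; import Data.Bool

-- value at position i of the interleaving of x⃗ (along φ) and y⃗ (along ψ):
-- x_j if i = φ(j), y_j if i = ψ(j).  (Always `just` for (φ,ψ) ∈ I_{k,ℓ}.)
interleaveAt : ∀ {A : Set} {n k ℓ : ℕ} → Vec (Fin n) k → Vec (Fin n) ℓ →
               Vec A k → Vec A ℓ → Fin n → Maybe A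
interleaveAt φ ψ xs ys i with preimage φ i | preimage ψ i
... | just j  | _       = just (Vec.lookup xs j)
... | nothing | just j  = just (Vec.lookup ys j)
... | nothing | nothing = nothing

interleave : ∀ {A : Set} {k ℓ : ℕ} → Vec (Fin (k + ℓ)) k → Vec (Fin (k + ℓ)) ℓ →
             Vec A k → Vec A ℓ → Maybe (List A)
interleave {k = k} {ℓ} φ ψ xs ys =
  sequenceMaybe (map (interleaveAt φ ψ xs ys) (allFin (k + ℓ)))

-- binomial coefficient with integer lower index (0 if negative or > top)
binomℤ : ℕ → ℤ → ℕ
binomℤ a (+ b)    = a C b
binomℤ a -[1+ _ ] = 0

-- positions are 0-based here: position i below is the paper's i+1.
-- ts = t⃗, hs = (h_i), es = (ε(i) = 1 ↔ true)
cAt : List ℕ → List ℕ → List Bool → ℕ → ℕ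
cAt ts hs es zero    = (at 0 ts 0 ∸ 1) C (at 0 hs 0 ∸ 1)
cAt ts hs es (suc i) =
  if not (at false es (suc i) xor at false es i)
  then (at 0 ts (suc i) ∸ 1) C (at 0 hs (suc i) ∸ 1)
  else binomℤ (at 0 ts (suc i) ∸ 1)
              (+ sum (take (suc (suc i)) ts) ℤ.- + sum (take (suc (suc i)) hs))

coeff : ∀ {k ℓ : ℕ} → Vec ℕ k → Vec ℕ ℓ → Vec ℕ (k + ℓ) →
        Vec (Fin (k + ℓ)) k → Vec (Fin (k + ℓ)) ℓ → ℕ
coeff {k} {ℓ} r s t φ ψ =
  product (map (cAt ts hs es) (upTo (k + ℓ)))
  where
    ts = Vec.toList t
    hs = map (λ i → Data.Maybe.fromMaybe 0 (interleaveAt φ ψ r s i)) (allFin (k + ℓ))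
      where import Data.Maybe
    es = map (inImage φ) (allFin (k + ℓ))

compositions : (m N : ℕ) → List (Vec ℕ m)
compositions m N =
  filter (λ t → Vec.sum t Data.Nat.≟ N) (allVecs (map suc (upTo N)) m)
  where import Data.Nat

rhs : ∀ {G : Set} {k ℓ : ℕ} → Vec ℕ k → Vec G k → Vec ℕ ℓ → Vec G ℓ →
      FreeAb (IWord G)
rhs {k = k} {ℓ} r a s b =
  concatMap (λ { (φ , ψ) →
    concatMap (λ t → term φ ψ t (interleave φ ψ a b))
              (compositions (k + ℓ) (Vec.sum r + Vec.sum s)) })
    (I k ℓ)
  where
    term : _ → _ → Vec ℕ (k + ℓ) → Maybe (List _) → FreeAb (IWord _)
    term φ ψ t (just ab) = (+ coeff r s t φ ψ , List.zip (Vec.toList t) ab) ∷ []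
    term φ ψ t nothing   = []

-- Under ρ⁻¹ the two words become x₀^(r₁-1) x_{a₁} ⋯ and x₀^(s₁-1) x_{b₁} ⋯. In a shuffle of them the
-- first non-x₀ letter is, say, x_{a₁}, preceded by r₁-1+i letters x₀ of which i come from the right
-- word; this happens in C(r₁-1+i, i) ways and leaves x₀^(s₁-1-i) x_{b₁} ⋯ on the right. The
-- right-hand side satisfies the same recursion: grouping its terms by the first sign and by
-- t₁ = r₁ + i, the first factor is C(t₁-1, r₁-1), and the remaining coefficients are those for
-- (r₂, …) and (s₁-i, s₂, …), since lowering s₁ by i is compensated by the deficit
-- Σ (t_j - h_j) = i entering the next crossing binomial; the terms with t₁ outside [r₁, r₁+s₁]
-- vanish. Induction on k + ℓ proves the identity once the sum over I_{k,ℓ} is re-indexed by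
-- sign words.
module Submission where

open import Defs
open import Data.Nat as N using (ℕ; zero; suc; _+_; _∸_; _≤_; _<_; z≤n; s≤s; _≡ᵇ_; _<ᵇ_)
import Data.Nat.Properties as NP
import Data.Nat.Tactic.RingSolver as ℕ-Solver
open import Data.Nat.Combinatorics using (_C_; nCk≡nC[n∸k]; nCn≡1; nCk+nC[k+1]≡[n+1]C[k+1]; k>n⇒nCk≡0)
open import Data.Nat.ListAction using (sum; product)
open import Data.Integer as ℤ using (ℤ; +_) renaming (_+_ to _⊕_; _*_ to _⊗_; _-_ to _⊝_)
import Data.Integer.Properties as ZP
open import Data.Integer.Tactic.RingSolver using (solve-∀)
open import Algebra.Properties.CommutativeSemigroup ZP.+-commutativeSemigroup using () renaming (interchange to +-interchange)
open import Data.Bool using (Bool; true; false; if_then_else_; _∧_; _xor_; not; T) renaming (_≟_ to _≟ᴮ_)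
open import Data.Bool.Properties using (xor-same)
open import Data.Maybe as Mb using (Maybe; just; nothing; is-just)
open import Data.Product using (_×_; _,_; proj₁; proj₂)
open import Data.Sum using (inj₁; inj₂)
open import Data.Fin as F using (Fin; toℕ)
import Data.Fin.Properties as FP
open import Data.List using (List; []; _∷_; _++_; map; concatMap; replicate; upTo; applyUpTo; allFin; take; filter; length; zip; tabulate)
import Data.List.Properties as LP
open import Data.List.Relation.Unary.All as All using ([]; _∷_) renaming (All to AllL)
import Data.List.Relation.Unary.All.Properties as AllP
open import Data.Vec as Vec using (Vec)
import Data.Vec.Properties as VP
open import Data.Vec.Relation.Unary.All using (All)
import Data.Vec.Relation.Unary.All as VAll
open import Data.Empty using (⊥-elim)
open import Data.Unit using (tt)
open import Function using (_∘_; id)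
open import Relation.Binary using (tri<; tri≈; tri>)
open import Relation.Binary.PropositionalEquality
open import Relation.Nullary using (Dec; does)
open import Relation.Nullary.Decidable using (⌊_⌋; isYes≗does)

-- Finite sums

∑ : ∀ {A : Set} → List A → (A → ℤ) → ℤ
∑ [] g = + 0
∑ (z ∷ xs) g = g z ⊕ ∑ xs g

∑< : ℕ → (ℕ → ℤ) → ℤ
∑< zero g = + 0
∑< (suc n) g = g 0 ⊕ ∑< n (λ i → g (suc i))

when : Bool → ℤ → ℤ
when true z = z
when false z = + 0

∑-++ : ∀ {A : Set} (xs ys : List A) g → ∑ (xs ++ ys) g ≡ ∑ xs g ⊕ ∑ ys g
∑-++ [] ys g = sym (ZP.+-identityˡ _)
∑-++ (z ∷ xs) ys g = trans (cong (g z ⊕_) (∑-++ xs ys g)) (sym (ZP.+-assoc (g z) _ _))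

∑-map : ∀ {A B : Set} (h : A → B) (xs : List A) g → ∑ (map h xs) g ≡ ∑ xs (g ∘ h)
∑-map h [] g = refl
∑-map h (z ∷ xs) g = cong (g (h z) ⊕_) (∑-map h xs g)

∑-concatMap : ∀ {A B : Set} (h : A → List B) (xs : List A) g → ∑ (concatMap h xs) g ≡ ∑ xs (λ z → ∑ (h z) g)
∑-concatMap h [] g = refl
∑-concatMap h (z ∷ xs) g = trans (∑-++ (h z) (concatMap h xs) g) (cong (∑ (h z) g ⊕_) (∑-concatMap h xs g))

∑-cong : ∀ {A : Set} (xs : List A) {g h : A → ℤ} → (∀ z → g z ≡ h z) → ∑ xs g ≡ ∑ xs h
∑-cong [] e = refl
∑-cong (z ∷ xs) e = cong₂ _⊕_ (e z) (∑-cong xs e)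

∑-congᴬ : ∀ {A : Set} {P : A → Set} {xs : List A} {g h : A → ℤ} → AllL P xs → (∀ z → P z → g z ≡ h z) → ∑ xs g ≡ ∑ xs h
∑-congᴬ [] e = refl
∑-congᴬ {xs = z ∷ xs} (px ∷ ps) e = cong₂ _⊕_ (e z px) (∑-congᴬ ps e)

∑-zero : ∀ {A : Set} (xs : List A) {g : A → ℤ} → (∀ z → g z ≡ + 0) → ∑ xs g ≡ + 0
∑-zero [] e = refl
∑-zero (z ∷ xs) e = cong₂ _⊕_ (e z) (∑-zero xs e)

∑-zeroᴬ : ∀ {A : Set} {P : A → Set} {xs : List A} {g : A → ℤ} → AllL P xs → (∀ z → P z → g z ≡ + 0) → ∑ xs g ≡ + 0
∑-zeroᴬ [] e = refl
∑-zeroᴬ {xs = z ∷ xs} (px ∷ ps) e = cong₂ _⊕_ (e z px) (∑-zeroᴬ ps e)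

∑-distrib-+ : ∀ {A : Set} (xs : List A) g h → ∑ xs (λ z → g z ⊕ h z) ≡ ∑ xs g ⊕ ∑ xs h
∑-distrib-+ [] g h = refl
∑-distrib-+ (z ∷ xs) g h = trans (cong (g z ⊕ h z ⊕_) (∑-distrib-+ xs g h)) (+-interchange (g z) (h z) (∑ xs g) (∑ xs h))

∑-*ˡ : ∀ {A : Set} (xs : List A) c g → c ⊗ ∑ xs g ≡ ∑ xs (λ z → c ⊗ g z)
∑-*ˡ [] c g = ZP.*-zeroʳ c
∑-*ˡ (z ∷ xs) c g = trans (ZP.*-distribˡ-+ c (g z) (∑ xs g)) (cong (c ⊗ g z ⊕_) (∑-*ˡ xs c g))

∑-swap : ∀ {A B : Set} (xs : List A) (ys : List B) (g : A → B → ℤ) →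
  ∑ xs (λ z → ∑ ys (λ y → g z y)) ≡ ∑ ys (λ y → ∑ xs (λ z → g z y))
∑-swap [] ys g = sym (∑-zero ys (λ _ → refl))
∑-swap (z ∷ xs) ys g = trans (cong (∑ ys (g z) ⊕_) (∑-swap xs ys g)) (sym (∑-distrib-+ ys (g z) (λ y → ∑ xs (λ x' → g x' y))))

∑-filter : ∀ {A : Set} {P : A → Set} (P? : ∀ z → Dec (P z)) (xs : List A) g →
  ∑ (filter P? xs) g ≡ ∑ xs (λ z → when (does (P? z)) (g z))
∑-filter P? [] g = refl
∑-filter P? (z ∷ xs) g with does (P? z)
... | true = cong (g z ⊕_) (∑-filter P? xs g)
... | false = trans (∑-filter P? xs g) (sym (ZP.+-identityˡ _))

when-zero : ∀ b → when b (+ 0) ≡ + 0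
when-zero true = refl
when-zero false = refl

when-* : ∀ b c d F → when b (+ (c N.* d) ⊗ F) ≡ + c ⊗ when b (+ d ⊗ F)
when-* true c d F = trans (cong (_⊗ F) (ZP.pos-* c d)) (ZP.*-assoc (+ c) (+ d) F)
when-* false c d F = sym (ZP.*-zeroʳ (+ c))

when-∑ : ∀ {A : Set} b (xs : List A) g → when b (∑ xs g) ≡ ∑ xs (λ z → when b (g z))
when-∑ true xs g = refl
when-∑ false xs g = sym (∑-zero xs (λ _ → refl))

∑-applyUpTo : ∀ (h : ℕ → ℕ) n g → ∑ (applyUpTo h n) g ≡ ∑< n (g ∘ h)
∑-applyUpTo h zero g = refl
∑-applyUpTo h (suc n) g = cong (g (h 0) ⊕_) (∑-applyUpTo (h ∘ suc) n g)

∑<-cong : ∀ n {g h : ℕ → ℤ} → (∀ i → i < n → g i ≡ h i) → ∑< n g ≡ ∑< n h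
∑<-cong zero e = refl
∑<-cong (suc n) e = cong₂ _⊕_ (e 0 (s≤s z≤n)) (∑<-cong n (λ i i<n → e (suc i) (s≤s i<n)))

∑<-zero : ∀ n {g : ℕ → ℤ} → (∀ i → i < n → g i ≡ + 0) → ∑< n g ≡ + 0
∑<-zero zero e = refl
∑<-zero (suc n) e = cong₂ _⊕_ (e 0 (s≤s z≤n)) (∑<-zero n (λ i i<n → e (suc i) (s≤s i<n)))

∑<-split : ∀ a b g → ∑< (a + b) g ≡ ∑< a g ⊕ ∑< b (λ i → g (a + i))
∑<-split zero b g = sym (ZP.+-identityˡ _)
∑<-split (suc a) b g = trans (cong (g 0 ⊕_) (∑<-split a b (λ i → g (suc i)))) (sym (ZP.+-assoc (g 0) _ _))

∑<-distrib-+ : ∀ n g h → ∑< n (λ z → g z ⊕ h z) ≡ ∑< n g ⊕ ∑< n h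
∑<-distrib-+ zero g h = refl
∑<-distrib-+ (suc n) g h = trans (cong (g 0 ⊕ h 0 ⊕_) (∑<-distrib-+ n (g ∘ suc) (h ∘ suc))) (+-interchange (g 0) (h 0) _ _)

∑<-delta : ∀ n c (h : ℕ → ℤ) → c < n → ∑< n (λ z → when (z ≡ᵇ c) (h z)) ≡ h c
∑<-delta (suc n) zero h c<n = trans (cong (h 0 ⊕_) (∑<-zero n (λ i _ → refl))) (ZP.+-identityʳ _)
∑<-delta (suc n) (suc c) h (s≤s c<n) = trans (ZP.+-identityˡ _) (∑<-delta n c (h ∘ suc) c<n)

evalLin-++ : ∀ {X : Set} (f : X → ℤ) (L M : FreeAb X) → evalLin f (L ++ M) ≡ evalLin f L ⊕ evalLin f M
evalLin-++ f [] M = sym (ZP.+-identityˡ _)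
evalLin-++ f ((c , z) ∷ L) M = trans (cong (c ⊗ f z ⊕_) (evalLin-++ f L M)) (sym (ZP.+-assoc (c ⊗ f z) (evalLin f L) (evalLin f M)))

evalLin-concatMap : ∀ {A X : Set} (f : X → ℤ) (h : A → FreeAb X) xs → evalLin f (concatMap h xs) ≡ ∑ xs (λ z → evalLin f (h z))
evalLin-concatMap f h [] = refl
evalLin-concatMap f h (z ∷ xs) = trans (evalLin-++ f (h z) (concatMap h xs)) (cong (evalLin f (h z) ⊕_) (evalLin-concatMap f h xs))
-- Shuffles

∑-⧢-comm : ∀ {A : Set} (u v : List A) F → ∑ (u ⧢ v) F ≡ ∑ (v ⧢ u) F
∑-⧢-comm [] [] F = refl
∑-⧢-comm [] (b ∷ v) F = refl
∑-⧢-comm (a ∷ u) [] F = refl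
∑-⧢-comm (a ∷ u) (b ∷ v) F = begin
    ∑ (map (a ∷_) (u ⧢ (b ∷ v)) ++ map (b ∷_) ((a ∷ u) ⧢ v)) F
  ≡⟨ ∑-++ (map (a ∷_) (u ⧢ (b ∷ v))) _ F ⟩
    ∑ (map (a ∷_) (u ⧢ (b ∷ v))) F ⊕ ∑ (map (b ∷_) ((a ∷ u) ⧢ v)) F
  ≡⟨ cong₂ _⊕_ (trans (∑-map (a ∷_) (u ⧢ (b ∷ v)) F) (∑-⧢-comm u (b ∷ v) (F ∘ (a ∷_))))
                (trans (∑-map (b ∷_) ((a ∷ u) ⧢ v) F) (∑-⧢-comm (a ∷ u) v (F ∘ (b ∷_)))) ⟩
    ∑ ((b ∷ v) ⧢ u) (F ∘ (a ∷_)) ⊕ ∑ (v ⧢ (a ∷ u)) (F ∘ (b ∷_))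
  ≡⟨ ZP.+-comm (∑ ((b ∷ v) ⧢ u) (F ∘ (a ∷_))) (∑ (v ⧢ (a ∷ u)) (F ∘ (b ∷_))) ⟩
    ∑ (v ⧢ (a ∷ u)) (F ∘ (b ∷_)) ⊕ ∑ ((b ∷ v) ⧢ u) (F ∘ (a ∷_))
  ≡⟨ sym (cong₂ _⊕_ (∑-map (b ∷_) (v ⧢ (a ∷ u)) F) (∑-map (a ∷_) ((b ∷ v) ⧢ u) F)) ⟩
    ∑ (map (b ∷_) (v ⧢ (a ∷ u))) F ⊕ ∑ (map (a ∷_) ((b ∷ v) ⧢ u)) F
  ≡⟨ sym (∑-++ (map (b ∷_) (v ⧢ (a ∷ u))) _ F) ⟩
    ∑ (map (b ∷_) (v ⧢ (a ∷ u)) ++ map (a ∷_) ((b ∷ v) ⧢ u)) F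
  ∎
  where open ≡-Reasoning

∑<-pascal : ∀ m N (X : ℕ → ℤ) →
  ∑< (suc N) (λ i → + ((suc m + i) C i) ⊗ X i) ≡
  ∑< (suc N) (λ i → + ((m + i) C i) ⊗ X i) ⊕ ∑< N (λ i → + ((suc m + i) C i) ⊗ X (suc i))
∑<-pascal m N X = begin
    + 1 ⊗ X 0 ⊕ ∑< N (λ i → + ((suc m + suc i) C suc i) ⊗ X (suc i))
  ≡⟨ cong (+ 1 ⊗ X 0 ⊕_) (trans (∑<-cong N (λ i _ → pascal i)) (∑<-distrib-+ N _ _)) ⟩
    + 1 ⊗ X 0 ⊕ (∑< N (λ i → + ((m + suc i) C suc i) ⊗ X (suc i)) ⊕ ∑< N (λ i → + ((suc m + i) C i) ⊗ X (suc i)))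
  ≡⟨ sym (ZP.+-assoc (+ 1 ⊗ X 0) _ _) ⟩
    + 1 ⊗ X 0 ⊕ ∑< N (λ i → + ((m + suc i) C suc i) ⊗ X (suc i)) ⊕ ∑< N (λ i → + ((suc m + i) C i) ⊗ X (suc i))
  ∎
  where
  open ≡-Reasoning
  pascal : ∀ i → + ((suc m + suc i) C suc i) ⊗ X (suc i) ≡ + ((m + suc i) C suc i) ⊗ X (suc i) ⊕ + ((suc m + i) C i) ⊗ X (suc i)
  pascal i = begin
      + ((suc m + suc i) C suc i) ⊗ X (suc i)
    ≡⟨ cong (λ z → + z ⊗ X (suc i)) (sym (nCk+nC[k+1]≡[n+1]C[k+1] (m + suc i) i)) ⟩
      + ((m + suc i) C i N.+ (m + suc i) C suc i) ⊗ X (suc i)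
    ≡⟨ cong (λ z → + (z C i N.+ (m + suc i) C suc i) ⊗ X (suc i)) (NP.+-suc m i) ⟩
      + ((suc m + i) C i N.+ (m + suc i) C suc i) ⊗ X (suc i)
    ≡⟨ cong (_⊗ X (suc i)) (ZP.pos-+ ((suc m + i) C i) ((m + suc i) C suc i)) ⟩
      (+ ((suc m + i) C i) ⊕ + ((m + suc i) C suc i)) ⊗ X (suc i)
    ≡⟨ ZP.*-distribʳ-+ (X (suc i)) (+ ((suc m + i) C i)) (+ ((m + suc i) C suc i)) ⟩
      + ((suc m + i) C i) ⊗ X (suc i) ⊕ + ((m + suc i) C suc i) ⊗ X (suc i)
    ≡⟨ ZP.+-comm (+ ((suc m + i) C i) ⊗ X (suc i)) (+ ((m + suc i) C suc i) ⊗ X (suc i)) ⟩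
      + ((m + suc i) C suc i) ⊗ X (suc i) ⊕ + ((suc m + i) C i) ⊗ X (suc i)
    ∎

-- Shuffling z^m a u with z^n b v, the first letter past the leading z's is either a,
-- preceded by z^(m+i) with i of the z's taken from the right (C(m+i,i) ways), or symmetrically b.
module LeadingRuns {A : Set} (z : A) where

  z^ : ℕ → List A
  z^ m = replicate m z

  leftFirst : ℕ → ℕ → A → List A → A → List A → (List A → ℤ) → ℕ → ℤ
  leftFirst m n a u b v F i = ∑ (u ⧢ (z^ (n ∸ i) ++ b ∷ v)) (λ w → F (z^ (m + i) ++ a ∷ w))

  rightFirst : ℕ → ℕ → A → List A → A → List A → (List A → ℤ) → ℕ → ℤ
  rightFirst m n a u b v F j = ∑ ((z^ (m ∸ j) ++ a ∷ u) ⧢ v) (λ w → F (z^ (n + j) ++ b ∷ w))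

  ∑-⧢-leadingRuns : ∀ m n a u b v (F : List A → ℤ) →
    ∑ ((z^ m ++ a ∷ u) ⧢ (z^ n ++ b ∷ v)) F ≡
    ∑< (suc n) (λ i → + ((m + i) C i) ⊗ leftFirst m n a u b v F i) ⊕ ∑< (suc m) (λ j → + ((n + j) C j) ⊗ rightFirst m n a u b v F j)
  ∑-⧢-leadingRuns zero zero a u b v F = begin
      ∑ (map (a ∷_) (u ⧢ (b ∷ v)) ++ map (b ∷_) ((a ∷ u) ⧢ v)) F
    ≡⟨ ∑-++ (map (a ∷_) (u ⧢ (b ∷ v))) _ F ⟩
      ∑ (map (a ∷_) (u ⧢ (b ∷ v))) F ⊕ ∑ (map (b ∷_) ((a ∷ u) ⧢ v)) F
    ≡⟨ cong₂ _⊕_ (∑-map (a ∷_) (u ⧢ (b ∷ v)) F) (∑-map (b ∷_) ((a ∷ u) ⧢ v) F) ⟩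
      P ⊕ Q
    ≡⟨ lem P Q ⟩
      (+ 1 ⊗ P ⊕ + 0) ⊕ (+ 1 ⊗ Q ⊕ + 0)
    ∎
    where
    open ≡-Reasoning
    P = ∑ (u ⧢ (b ∷ v)) (λ w → F (a ∷ w))
    Q = ∑ ((a ∷ u) ⧢ v) (λ w → F (b ∷ w))
    lem : ∀ P Q → P ⊕ Q ≡ (+ 1 ⊗ P ⊕ + 0) ⊕ (+ 1 ⊗ Q ⊕ + 0)
    lem = solve-∀
  ∑-⧢-leadingRuns (suc m) zero a u b v F = begin
      ∑ (map (z ∷_) ((z^ m ++ a ∷ u) ⧢ (b ∷ v)) ++ map (b ∷_) ((z ∷ z^ m ++ a ∷ u) ⧢ v)) F
    ≡⟨ ∑-++ (map (z ∷_) ((z^ m ++ a ∷ u) ⧢ (b ∷ v))) _ F ⟩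
      ∑ (map (z ∷_) ((z^ m ++ a ∷ u) ⧢ (b ∷ v))) F ⊕ ∑ (map (b ∷_) ((z ∷ z^ m ++ a ∷ u) ⧢ v)) F
    ≡⟨ cong₂ _⊕_ (trans (∑-map (z ∷_) ((z^ m ++ a ∷ u) ⧢ (b ∷ v)) F) (∑-⧢-leadingRuns m zero a u b v F')) (∑-map (b ∷_) ((z ∷ z^ m ++ a ∷ u) ⧢ v) F) ⟩
      (L ⊕ ∑< (suc m) (λ j → + ((zero + j) C j) ⊗ rightFirst m zero a u b v F' j)) ⊕ R
    ≡⟨ cong (λ y → (L ⊕ y) ⊕ R) (∑<-cong (suc m) (λ j _ → cong (λ c → + c ⊗ rightFirst m zero a u b v F' j) (trans (nCn≡1 j) (sym (nCn≡1 (suc j)))))) ⟩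
      (L ⊕ Rs) ⊕ R
    ≡⟨ lem L Rs R ⟩
      L ⊕ (+ 1 ⊗ R ⊕ Rs)
    ∎
    where
    open ≡-Reasoning
    F' = F ∘ (z ∷_)
    L = ∑< 1 (λ i → + ((m + i) C i) ⊗ leftFirst m zero a u b v F' i)
    R = ∑ ((z ∷ z^ m ++ a ∷ u) ⧢ v) (λ w → F (b ∷ w))
    Rs = ∑< (suc m) (λ j → + ((suc j) C (suc j)) ⊗ rightFirst m zero a u b v F' j)
    lem : ∀ X Y Z → (X ⊕ Y) ⊕ Z ≡ X ⊕ (+ 1 ⊗ Z ⊕ Y)
    lem = solve-∀
  ∑-⧢-leadingRuns zero (suc n) a u b v F = begin
      ∑ (map (a ∷_) (u ⧢ (z ∷ z^ n ++ b ∷ v)) ++ map (z ∷_) ((a ∷ u) ⧢ (z^ n ++ b ∷ v))) F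
    ≡⟨ ∑-++ (map (a ∷_) (u ⧢ (z ∷ z^ n ++ b ∷ v))) _ F ⟩
      ∑ (map (a ∷_) (u ⧢ (z ∷ z^ n ++ b ∷ v))) F ⊕ ∑ (map (z ∷_) ((a ∷ u) ⧢ (z^ n ++ b ∷ v))) F
    ≡⟨ cong₂ _⊕_ (∑-map (a ∷_) (u ⧢ (z ∷ z^ n ++ b ∷ v)) F) (trans (∑-map (z ∷_) ((a ∷ u) ⧢ (z^ n ++ b ∷ v)) F) (∑-⧢-leadingRuns zero n a u b v F')) ⟩
      L ⊕ (∑< (suc n) (λ i → + ((zero + i) C i) ⊗ leftFirst zero n a u b v F' i) ⊕ R)
    ≡⟨ cong (λ y → L ⊕ (y ⊕ R)) (∑<-cong (suc n) (λ i _ → cong (λ c → + c ⊗ leftFirst zero n a u b v F' i) (trans (nCn≡1 i) (sym (nCn≡1 (suc i)))))) ⟩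
      L ⊕ (Ls ⊕ R)
    ≡⟨ lem L Ls R ⟩
      (+ 1 ⊗ L ⊕ Ls) ⊕ R
    ∎
    where
    open ≡-Reasoning
    F' = F ∘ (z ∷_)
    L = ∑ (u ⧢ (z ∷ z^ n ++ b ∷ v)) (λ w → F (a ∷ w))
    Ls = ∑< (suc n) (λ i → + ((suc i) C (suc i)) ⊗ leftFirst zero n a u b v F' i)
    R = ∑< 1 (λ j → + ((n + j) C j) ⊗ rightFirst zero n a u b v F' j)
    lem : ∀ X Y Z → X ⊕ (Y ⊕ Z) ≡ (+ 1 ⊗ X ⊕ Y) ⊕ Z
    lem = solve-∀
  ∑-⧢-leadingRuns (suc m) (suc n) a u b v F = begin
      ∑ (map (z ∷_) (P ⧢ (z ∷ Q)) ++ map (z ∷_) ((z ∷ P) ⧢ Q)) F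
    ≡⟨ ∑-++ (map (z ∷_) (P ⧢ (z ∷ Q))) _ F ⟩
      ∑ (map (z ∷_) (P ⧢ (z ∷ Q))) F ⊕ ∑ (map (z ∷_) ((z ∷ P) ⧢ Q)) F
    ≡⟨ cong₂ _⊕_ (trans (∑-map (z ∷_) (P ⧢ (z ∷ Q)) F) (∑-⧢-leadingRuns m (suc n) a u b v F'))
                  (trans (∑-map (z ∷_) ((z ∷ P) ⧢ Q) F) (∑-⧢-leadingRuns (suc m) n a u b v F')) ⟩
      (X₁ ⊕ Y₁) ⊕ (X₂ ⊕ Y₂)
    ≡⟨ lem X₁ Y₁ X₂ Y₂ ⟩
      (X₁ ⊕ X₂) ⊕ (Y₂ ⊕ Y₁)
    ≡⟨ cong₂ _⊕_ (trans (cong (X₁ ⊕_) (∑<-cong (suc n) (λ i _ → cong (+ ((suc m + i) C i) ⊗_) (shiftˡ i)))) (sym (∑<-pascal m (suc n) X)))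
                  (trans (cong (Y₂ ⊕_) (∑<-cong (suc m) (λ j _ → cong (+ ((suc n + j) C j) ⊗_) (shiftʳ j)))) (sym (∑<-pascal n (suc m) Y))) ⟩
      ∑< (suc (suc n)) (λ i → + ((suc m + i) C i) ⊗ X i) ⊕ ∑< (suc (suc m)) (λ j → + ((suc n + j) C j) ⊗ Y j)
    ∎
    where
    open ≡-Reasoning
    P = z^ m ++ a ∷ u
    Q = z^ n ++ b ∷ v
    F' = F ∘ (z ∷_)
    X₁ = ∑< (suc (suc n)) (λ i → + ((m + i) C i) ⊗ leftFirst m (suc n) a u b v F' i)
    Y₁ = ∑< (suc m) (λ j → + ((suc n + j) C j) ⊗ rightFirst m (suc n) a u b v F' j)
    X₂ = ∑< (suc n) (λ i → + ((suc m + i) C i) ⊗ leftFirst (suc m) n a u b v F' i)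
    Y₂ = ∑< (suc (suc m)) (λ j → + ((n + j) C j) ⊗ rightFirst (suc m) n a u b v F' j)
    X = leftFirst (suc m) (suc n) a u b v F
    Y = rightFirst (suc m) (suc n) a u b v F
    shiftˡ : ∀ i → leftFirst (suc m) n a u b v F' i ≡ X (suc i)
    shiftˡ i = ∑-cong (u ⧢ (z^ (n ∸ i) ++ b ∷ v)) (λ w → cong (λ k → F (z ∷ z^ k ++ a ∷ w)) (sym (NP.+-suc m i)))
    shiftʳ : ∀ j → rightFirst m (suc n) a u b v F' j ≡ Y (suc j)
    shiftʳ j = ∑-cong ((z^ (m ∸ j) ++ a ∷ u) ⧢ v) (λ w → cong (λ k → F (z ∷ z^ k ++ b ∷ w)) (sym (NP.+-suc n j)))
    lem : ∀ X₁ Y₁ X₂ Y₂ → (X₁ ⊕ Y₁) ⊕ (X₂ ⊕ Y₂) ≡ (X₁ ⊕ X₂) ⊕ (Y₂ ⊕ Y₁)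
    lem = solve-∀

-- The map ρ

module _ {G : Set} where
  open LeadingRuns (x₀ {G}) using () renaming (z^ to x₀^)

  Positive : List (ℕ × G) → Set
  Positive = AllL (λ y → 1 ≤ proj₁ y)

  ρ-go-x₀^ : ∀ p c (w : List (Letter G)) → ρ-go c (x₀^ p ++ w) ≡ ρ-go (p + c) w
  ρ-go-x₀^ zero c w = refl
  ρ-go-x₀^ (suc p) c w = trans (ρ-go-x₀^ p (suc c) w) (cong (λ k → ρ-go k w) (NP.+-suc p c))

  ρ-block : ∀ p (a : G) w → ρ (x₀^ p ++ x a ∷ w) ≡ (suc p , a) ∷ ρ w
  ρ-block p a w = trans (ρ-go-x₀^ p 0 (x a ∷ w)) (cong (λ k → (suc k , a) ∷ ρ w) (NP.+-identityʳ p))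

  ρ∘ρ⁻¹ : ∀ (u : List (ℕ × G)) → Positive u → ρ (ρ⁻¹ u) ≡ u
  ρ∘ρ⁻¹ [] [] = refl
  ρ∘ρ⁻¹ ((suc s , b) ∷ u) (s≤s _ ∷ pu) = trans (ρ-block s b (ρ⁻¹ u)) (cong ((suc s , b) ∷_) (ρ∘ρ⁻¹ u pu))
-- A recursive model of the right-hand side

-- A shuffle (φ, ψ) ∈ I_{k,ℓ} is encoded by its sign word es (es_i = true iff ε(i) = 1).
-- coeffFrom p D ts hs es is the product of the c(i) over the positions still to come,
-- where p = ε(i-1) and D = Σ_{j<i} (t_j - h_j) is the deficit accumulated so far.
coeffFrom : Bool → ℤ → List ℕ → List ℕ → List Bool → ℕ
coeffFrom p D (t ∷ ts) (h ∷ hs) (e ∷ es) =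
  (if not (e xor p) then (t ∸ 1) C (h ∸ 1) else binomℤ (t ∸ 1) (D ⊕ (+ t ⊝ + h))) N.* coeffFrom e (D ⊕ (+ t ⊝ + h)) ts hs es
coeffFrom p D _ _ _ = 1

merge : ∀ {X : Set} → List Bool → List X → List X → List X
merge (true ∷ es) (y ∷ u) v = y ∷ merge es u v
merge (false ∷ es) u (y ∷ v) = y ∷ merge es u v
merge _ _ _ = []

data Counts : List Bool → ℕ → ℕ → Set where
  c[] : Counts [] 0 0
  cᵗ : ∀ {es k ℓ} → Counts es k ℓ → Counts (true ∷ es) (suc k) ℓ
  cᶠ : ∀ {es k ℓ} → Counts es k ℓ → Counts (false ∷ es) k (suc ℓ)

patterns : ℕ → ℕ → List (List Bool)
patterns zero zero = [] ∷ []
patterns zero (suc ℓ) = map (false ∷_) (patterns zero ℓ)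
patterns (suc k) zero = map (true ∷_) (patterns k zero)
patterns (suc k) (suc ℓ) = map (true ∷_) (patterns k (suc ℓ)) ++ map (false ∷_) (patterns (suc k) ℓ)

tuples : List ℕ → ℕ → List (List ℕ)
tuples xs zero = [] ∷ []
tuples xs (suc n) = concatMap (λ y → map (y ∷_) (tuples xs n)) xs

All-patterns : ∀ k ℓ → AllL (λ es → Counts es k ℓ) (patterns k ℓ)
All-patterns zero zero = c[] ∷ []
All-patterns zero (suc ℓ) = AllP.gmap⁺ cᶠ (All-patterns zero ℓ)
All-patterns (suc k) zero = AllP.gmap⁺ cᵗ (All-patterns k zero)
All-patterns (suc k) (suc ℓ) = AllP.++⁺ (AllP.gmap⁺ cᵗ (All-patterns k (suc ℓ))) (AllP.gmap⁺ cᶠ (All-patterns (suc k) ℓ))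

All-tuples : ∀ {Q : ℕ → Set} xs n → AllL Q xs → AllL (λ t → length t ≡ n × AllL Q t) (tuples xs n)
All-tuples xs zero q = (refl , []) ∷ []
All-tuples {Q} xs (suc n) q = go xs q
  where
  go : ∀ ys → AllL Q ys → AllL (λ t → length t ≡ suc n × AllL Q t) (concatMap (λ y → map (y ∷_) (tuples xs n)) ys)
  go [] [] = []
  go (y ∷ ys) (qy ∷ qs) = AllP.++⁺ (AllP.gmap⁺ (λ (e , qt) → cong suc e , qy ∷ qt) (All-tuples xs n q)) (go ys qs)

All-positiveRange : ∀ M → AllL (1 ≤_) (map suc (upTo M))
All-positiveRange M = AllP.map⁺ (AllP.applyUpTo⁺₂ id M (λ _ → s≤s z≤n))

Counts-length : ∀ {es k ℓ} → Counts es k ℓ → length es ≡ k + ℓ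
Counts-length c[] = refl
Counts-length (cᵗ ce) = cong suc (Counts-length ce)
Counts-length {false ∷ es} {k} {suc ℓ} (cᶠ ce) = trans (cong suc (Counts-length ce)) (sym (NP.+-suc k ℓ))

module _ {X : Set} where
  merge-not : ∀ es (u v : List X) → merge (map not es) u v ≡ merge es v u
  merge-not [] u v = refl
  merge-not (true ∷ es) u [] = refl
  merge-not (true ∷ es) u (y ∷ v) = cong (y ∷_) (merge-not es u v)
  merge-not (false ∷ es) [] v = refl
  merge-not (false ∷ es) (y ∷ u) v = cong (y ∷_) (merge-not es u v)

  merge-All : ∀ {P : X → Set} es (u v : List X) → AllL P u → AllL P v → AllL P (merge es u v)
  merge-All [] u v pu pv = []
  merge-All (true ∷ es) [] v pu pv = []
  merge-All (true ∷ es) (y ∷ u) v (p ∷ pu) pv = p ∷ merge-All es u v pu pv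
  merge-All (false ∷ es) u [] pu pv = []
  merge-All (false ∷ es) u (y ∷ v) pu (p ∷ pv) = p ∷ merge-All es u v pu pv

  length-merge : ∀ es (u v : List X) → Counts es (length u) (length v) → length (merge es u v) ≡ length es
  length-merge [] u v ce = refl
  length-merge (true ∷ es) (y ∷ u) v (cᵗ ce) = cong suc (length-merge es u v ce)
  length-merge (false ∷ es) u (y ∷ v) (cᶠ ce) = cong suc (length-merge es u v ce)

module _ {G : Set} where
  merge-proj₂ : ∀ es (u v : List (ℕ × G)) s s' (b : G) → map proj₂ (merge es u ((s , b) ∷ v)) ≡ map proj₂ (merge es u ((s' , b) ∷ v))
  merge-proj₂ [] u v s s' b = refl
  merge-proj₂ (true ∷ es) [] v s s' b = refl
  merge-proj₂ (true ∷ es) (y ∷ u) v s s' b = cong (proj₂ y ∷_) (merge-proj₂ es u v s s' b)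
  merge-proj₂ (false ∷ es) u v s s' b = refl

  positive-heights : ∀ es (u v : List (ℕ × G)) → Positive u → Positive v → AllL (1 ≤_) (map proj₁ (merge es u v))
  positive-heights es u v pu pv = AllP.map⁺ (merge-All es u v pu pv)

xor-not : ∀ e p → not e xor not p ≡ e xor p
xor-not true true = refl
xor-not true false = refl
xor-not false true = refl
xor-not false false = refl

coeffFrom-not : ∀ p D t hs es → coeffFrom (not p) D t hs (map not es) ≡ coeffFrom p D t hs es
coeffFrom-not p D [] hs es = refl
coeffFrom-not p D (t ∷ ts) [] es = refl
coeffFrom-not p D (t ∷ ts) (h ∷ hs) [] = refl
coeffFrom-not p D (t ∷ ts) (h ∷ hs) (e ∷ es) rewrite xor-not e p =
  cong ((if not (e xor p) then (t ∸ 1) C (h ∸ 1) else binomℤ (t ∸ 1) (D ⊕ (+ t ⊝ + h))) N.*_) (coeffFrom-not e (D ⊕ (+ t ⊝ + h)) ts hs es)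

+m-+n≡+[m∸n] : ∀ m n → n ≤ m → + m ⊝ + n ≡ + (m ∸ n)
+m-+n≡+[m∸n] m n n≤m = trans (ZP.m-n≡m⊖n m n) (ZP.⊖-≥ n≤m)

deficit-shift : ∀ D i t s → i ≤ s → (D ⊝ + i) ⊕ (+ t ⊝ + (s ∸ i)) ≡ D ⊕ (+ t ⊝ + s)
deficit-shift D i t s i≤s rewrite sym (+m-+n≡+[m∸n] s i i≤s) = lem D (+ i) (+ t) (+ s)
  where
  lem : ∀ D i t s → (D ⊝ i) ⊕ (t ⊝ (s ⊝ i)) ≡ D ⊕ (t ⊝ s)
  lem = solve-∀

binomℤ-initial : ∀ t h → binomℤ t (+ 0 ⊕ (+ suc t ⊝ + suc h)) ≡ t C h
binomℤ-initial t h with NP.≤-<-connex h t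
... | inj₁ h≤t = begin
    binomℤ t (+ 0 ⊕ (+ suc t ⊝ + suc h))
  ≡⟨ cong (binomℤ t) (trans (ZP.+-identityˡ _) (+m-+n≡+[m∸n] (suc t) (suc h) (s≤s h≤t))) ⟩
    t C (t ∸ h)
  ≡⟨ sym (nCk≡nC[n∸k] h≤t) ⟩
    t C h
  ∎
  where open ≡-Reasoning
... | inj₂ t<h = begin
    binomℤ t (+ 0 ⊕ (+ suc t ⊝ + suc h))
  ≡⟨ cong (binomℤ t) (trans (ZP.+-identityˡ _) (trans (ZP.m-n≡m⊖n (suc t) (suc h)) (ZP.⊖-< (s≤s t<h)))) ⟩
    binomℤ t (ℤ.- (+ (suc h ∸ suc t)))
  ≡⟨ cong (λ k → binomℤ t (ℤ.- (+ k))) (NP.+-∸-assoc 1 {h} {suc t} t<h) ⟩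
    0
  ≡⟨ sym (k>n⇒nCk≡0 t<h) ⟩
    t C h
  ∎
  where open ≡-Reasoning

∑-patterns-not : ∀ k ℓ (g : List Bool → ℤ) → ∑ (patterns k ℓ) g ≡ ∑ (patterns ℓ k) (λ es → g (map not es))
∑-patterns-not zero zero g = refl
∑-patterns-not zero (suc ℓ) g = trans (∑-map (false ∷_) (patterns zero ℓ) g) (trans (∑-patterns-not zero ℓ (g ∘ (false ∷_))) (sym (∑-map (true ∷_) (patterns ℓ zero) (λ es → g (map not es)))))
∑-patterns-not (suc k) zero g = trans (∑-map (true ∷_) (patterns k zero) g) (trans (∑-patterns-not k zero (g ∘ (true ∷_))) (sym (∑-map (false ∷_) (patterns zero k) (λ es → g (map not es)))))
∑-patterns-not (suc k) (suc ℓ) g = begin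
    ∑ (map (true ∷_) (patterns k (suc ℓ)) ++ map (false ∷_) (patterns (suc k) ℓ)) g
  ≡⟨ ∑-++ (map (true ∷_) (patterns k (suc ℓ))) (map (false ∷_) (patterns (suc k) ℓ)) g ⟩
    ∑ (map (true ∷_) (patterns k (suc ℓ))) g ⊕ ∑ (map (false ∷_) (patterns (suc k) ℓ)) g
  ≡⟨ cong₂ _⊕_ (trans (∑-map (true ∷_) (patterns k (suc ℓ)) g) (∑-patterns-not k (suc ℓ) (g ∘ (true ∷_))))
                (trans (∑-map (false ∷_) (patterns (suc k) ℓ) g) (∑-patterns-not (suc k) ℓ (g ∘ (false ∷_)))) ⟩
    ∑ (patterns (suc ℓ) k) (λ es → g (true ∷ map not es)) ⊕ ∑ (patterns ℓ (suc k)) (λ es → g (false ∷ map not es))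
  ≡⟨ ZP.+-comm (∑ (patterns (suc ℓ) k) (λ es → g (true ∷ map not es))) _ ⟩
    ∑ (patterns ℓ (suc k)) (λ es → g (false ∷ map not es)) ⊕ ∑ (patterns (suc ℓ) k) (λ es → g (true ∷ map not es))
  ≡⟨ sym (cong₂ _⊕_ (∑-map (true ∷_) (patterns ℓ (suc k)) (λ es → g (map not es))) (∑-map (false ∷_) (patterns (suc ℓ) k) (λ es → g (map not es)))) ⟩
    ∑ (map (true ∷_) (patterns ℓ (suc k))) (λ es → g (map not es)) ⊕ ∑ (map (false ∷_) (patterns (suc ℓ) k)) (λ es → g (map not es))
  ≡⟨ sym (∑-++ (map (true ∷_) (patterns ℓ (suc k))) (map (false ∷_) (patterns (suc ℓ) k)) (λ es → g (map not es))) ⟩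
    ∑ (map (true ∷_) (patterns ℓ (suc k)) ++ map (false ∷_) (patterns (suc ℓ) k)) (λ es → g (map not es))
  ∎
  where open ≡-Reasoning

module _ {G : Set} where
  weight : List (ℕ × G) → ℕ
  weight u = sum (map proj₁ u)

  -- Entries of t run over 1..M; any M ≥ N gives the same value, and keeping M fixed
  -- lets the induction below change N.
  patternValue : ℕ → ℕ → ℕ → List (ℕ × G) → List (ℕ × G) → (IWord G → ℤ) → List Bool → ℤ
  patternValue M n N u v f es = ∑ (tuples (map suc (upTo M)) n) (λ t →
     when (sum t ≡ᵇ N) (+ coeffFrom (at false es 0) (+ 0) t (map proj₁ (merge es u v)) es ⊗ f (zip t (map proj₂ (merge es u v)))))

  rhsValue : ℕ → ℕ → List (ℕ × G) → List (ℕ × G) → (IWord G → ℤ) → ℕ → ℤ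
  rhsValue k ℓ u v f M = ∑ (patterns k ℓ) (patternValue M (k + ℓ) (weight u + weight v) u v f)

  patternValue-not : ∀ M n N u v f es → patternValue M n N u v f (map not es) ≡ patternValue M n N v u f es
  patternValue-not M n N u v f [] = refl
  patternValue-not M n N u v f (e ∷ es) = ∑-cong (tuples (map suc (upTo M)) n) (λ t →
    cong₂ (λ c w → when (sum t ≡ᵇ N) (+ c ⊗ f (zip t (map proj₂ w))))
      (trans (cong (λ w → coeffFrom (not e) (+ 0) t (map proj₁ w) (not e ∷ map not es)) (merge-not (e ∷ es) u v)) (coeffFrom-not e (+ 0) t _ (e ∷ es)))
      (merge-not (e ∷ es) u v))

  rhsValue-comm : ∀ k ℓ u v f M → rhsValue k ℓ u v f M ≡ rhsValue ℓ k v u f M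
  rhsValue-comm k ℓ u v f M = begin
      ∑ (patterns k ℓ) (patternValue M (k + ℓ) (weight u + weight v) u v f)
    ≡⟨ ∑-patterns-not k ℓ _ ⟩
      ∑ (patterns ℓ k) (λ es → patternValue M (k + ℓ) (weight u + weight v) u v f (map not es))
    ≡⟨ ∑-cong (patterns ℓ k) (patternValue-not M (k + ℓ) (weight u + weight v) u v f) ⟩
      ∑ (patterns ℓ k) (patternValue M (k + ℓ) (weight u + weight v) v u f)
    ≡⟨ cong₂ (λ n N → ∑ (patterns ℓ k) (patternValue M n N v u f)) (NP.+-comm k ℓ) (NP.+-comm (weight u) (weight v)) ⟩
      ∑ (patterns ℓ k) (patternValue M (ℓ + k) (weight v + weight u) v u f)
    ∎
    where open ≡-Reasoning

  coeffFrom-shift : ∀ es (u v : List (ℕ × G)) s b i D t → i ≤ s →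
    coeffFrom true D t (map proj₁ (merge es u ((s , b) ∷ v))) es ≡ coeffFrom true (D ⊝ + i) t (map proj₁ (merge es u ((s ∸ i , b) ∷ v))) es
  coeffFrom-shift es u v s b i D [] i≤s = refl
  coeffFrom-shift [] u v s b i D (t ∷ ts) i≤s = refl
  coeffFrom-shift (true ∷ es) [] v s b i D (t ∷ ts) i≤s = refl
  coeffFrom-shift (true ∷ es) ((h , a) ∷ u) v s b i D (t ∷ ts) i≤s =
    cong (((t ∸ 1) C (h ∸ 1)) N.*_) (trans (coeffFrom-shift es u v s b i (D ⊕ (+ t ⊝ + h)) ts i≤s) (cong (λ z → coeffFrom true z ts _ es) (lem D (+ i) (+ t ⊝ + h))))
    where
    lem : ∀ D i e → (D ⊕ e) ⊝ i ≡ (D ⊝ i) ⊕ e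
    lem = solve-∀
  coeffFrom-shift (false ∷ es) u v s b i D (t ∷ ts) i≤s =
    cong (λ z → binomℤ (t ∸ 1) z N.* coeffFrom false z ts (map proj₁ (merge es u v)) es) (sym (deficit-shift D i t s i≤s))

  -- Once the deficit reaches the height s of the next right letter, the crossing binomial
  -- C(t-1, deficit + t - s) at that letter has lower index ≥ t.
  coeffFrom-vanishes : ∀ es (u v : List (ℕ × G)) s b d t → Counts es (length u) (suc (length v)) → length t ≡ length es →
    AllL (1 ≤_) t → Positive u → s ≤ d → coeffFrom true (+ d) t (map proj₁ (merge es u ((s , b) ∷ v))) es ≡ 0
  coeffFrom-vanishes (true ∷ es) ((suc h , a) ∷ u) v s b d (suc t ∷ ts) (cᵗ ce) lt (s≤s z≤n ∷ pt) (s≤s z≤n ∷ pu) s≤d with NP.≤-<-connex h t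
  ... | inj₁ h≤t = trans (cong ((t C h) N.*_) (trans (cong (λ z → coeffFrom true z ts _ es) (trans (cong (+ d ⊕_) (+m-+n≡+[m∸n] (suc t) (suc h) (s≤s h≤t))) (sym (ZP.pos-+ d (t ∸ h)))))
                             (coeffFrom-vanishes es u v s b (d + (t ∸ h)) ts ce (NP.suc-injective lt) pt pu (NP.≤-trans s≤d (NP.m≤m+n d (t ∸ h))))))
                         (NP.*-zeroʳ (t C h))
  ... | inj₂ t<h = cong (N._* coeffFrom true (+ d ⊕ (+ suc t ⊝ + suc h)) ts (map proj₁ (merge es u ((s , b) ∷ v))) es) (k>n⇒nCk≡0 t<h)
  coeffFrom-vanishes (false ∷ es) u v s b d (suc t ∷ ts) ce lt (s≤s z≤n ∷ pt) pu s≤d =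
    cong (N._* coeffFrom false (+ d ⊕ (+ suc t ⊝ + s)) ts (map proj₁ (merge es u v)) es)
      (trans (cong (binomℤ t) deficit) (k>n⇒nCk≡0 (NP.≤-trans (NP.n<1+n t) (NP.m≤n+m (suc t) (d ∸ s)))))
    where
    deficit : + d ⊕ (+ suc t ⊝ + s) ≡ + (d ∸ s + suc t)
    deficit = begin
        + d ⊕ (+ suc t ⊝ + s)
      ≡⟨ lem (+ d) (+ suc t) (+ s) ⟩
        (+ d ⊝ + s) ⊕ + suc t
      ≡⟨ cong (_⊕ + suc t) (+m-+n≡+[m∸n] d s s≤d) ⟩
        + (d ∸ s) ⊕ + suc t
      ≡⟨ sym (ZP.pos-+ (d ∸ s) (suc t)) ⟩
        + (d ∸ s + suc t)
      ∎
      where open ≡-Reasoning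
            lem : ∀ d t s → d ⊕ (t ⊝ s) ≡ (d ⊝ s) ⊕ t
            lem = solve-∀

-- At the first position the crossing binomial C(t-1, t-h) equals C(t-1, h-1),
-- so the initial sign is irrelevant.
coeffFrom-start : ∀ t hs es → AllL (1 ≤_) t → AllL (1 ≤_) hs → coeffFrom true (+ 0) t hs es ≡ coeffFrom (at false es 0) (+ 0) t hs es
coeffFrom-start [] hs es pt ph = refl
coeffFrom-start (t ∷ ts) [] es pt ph = refl
coeffFrom-start (t ∷ ts) (h ∷ hs) [] pt ph = refl
coeffFrom-start (t ∷ ts) (h ∷ hs) (true ∷ es) pt ph = refl
coeffFrom-start (suc t ∷ ts) (suc h ∷ hs) (false ∷ es) (s≤s z≤n ∷ pt) (s≤s z≤n ∷ ph) =
  cong (N._* coeffFrom false (+ 0 ⊕ (+ suc t ⊝ + suc h)) ts hs es) (binomℤ-initial t h)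
-- The induction

≡ᵇ-refl : ∀ n → (n ≡ᵇ n) ≡ true
≡ᵇ-refl zero = refl
≡ᵇ-refl (suc n) = ≡ᵇ-refl n

≢⇒≡ᵇ-false : ∀ m n → m ≢ n → (m ≡ᵇ n) ≡ false
≢⇒≡ᵇ-false m n m≢n with m ≡ᵇ n in eq
... | true = ⊥-elim (m≢n (NP.≡ᵇ⇒≡ m n (subst T (sym eq) tt)))
... | false = refl

+-≡ᵇ-cancelˡ : ∀ c y z → (c + y ≡ᵇ c + z) ≡ (y ≡ᵇ z)
+-≡ᵇ-cancelˡ zero y z = refl
+-≡ᵇ-cancelˡ (suc c) y z = +-≡ᵇ-cancelˡ c y z

All-≤-sum : ∀ hs → AllL (_≤ sum hs) hs
All-≤-sum [] = []
All-≤-sum (h ∷ hs) = NP.m≤m+n h (sum hs) ∷ All.map (λ le → NP.≤-trans le (NP.m≤n+m (sum hs) h)) (All-≤-sum hs)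

binomials : List ℕ → List ℕ → ℕ
binomials (t ∷ ts) (h ∷ hs) = ((t ∸ 1) C (h ∸ 1)) N.* binomials ts hs
binomials _ _ = 1

coeffFrom-noCrossing : ∀ D t hs n → length hs ≡ n → coeffFrom false D t hs (replicate n false) ≡ binomials t hs
coeffFrom-noCrossing D [] hs n e = refl
coeffFrom-noCrossing D (t ∷ ts) [] n e = refl
coeffFrom-noCrossing D (t ∷ ts) (h ∷ hs) (suc n) e = cong (((t ∸ 1) C (h ∸ 1)) N.*_) (coeffFrom-noCrossing _ ts hs n (NP.suc-injective e))

-- Only t = hs contributes: an entry t_i < h_i kills its binomial, and an entry t_i > h_i
-- pushes the total above N'.
∑-tuples-binomials : ∀ M (hs : List ℕ) → AllL (1 ≤_) hs → AllL (_≤ M) hs → ∀ c N' (g : List ℕ → ℤ) → N' ≤ c + sum hs →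
  ∑ (tuples (map suc (upTo M)) (length hs)) (λ t → when (c + sum t ≡ᵇ N') (+ binomials t hs ⊗ g t)) ≡ when (c + sum hs ≡ᵇ N') (g hs)
∑-tuples-binomials M [] ph hM c N' g le = trans (ZP.+-identityʳ _) (cong (when (c + 0 ≡ᵇ N')) (ZP.*-identityˡ (g [])))
∑-tuples-binomials M (suc h ∷ hs) (s≤s z≤n ∷ ph) (h<M ∷ hM) c N' g le = begin
    ∑ (concatMap (λ y → map (y ∷_) (tuples xs n)) xs) body
  ≡⟨ ∑-concatMap (λ y → map (y ∷_) (tuples xs n)) xs body ⟩
    ∑ xs (λ y → ∑ (map (y ∷_) (tuples xs n)) body)
  ≡⟨ ∑-congᴬ (All-positiveRange M) (λ y 1≤y → trans (∑-map (y ∷_) (tuples xs n) body) (firstEntry y 1≤y)) ⟩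
    ∑ xs (λ y → when (y ≡ᵇ suc h) X)
  ≡⟨ trans (∑-map suc (upTo M) (λ y → when (y ≡ᵇ suc h) X)) (∑-applyUpTo id M (λ y → when (suc y ≡ᵇ suc h) X)) ⟩
    ∑< M (λ j → when (j ≡ᵇ h) X)
  ≡⟨ ∑<-delta M h (λ _ → X) h<M ⟩
    X
  ∎
  where
  open ≡-Reasoning
  xs = map suc (upTo M)
  n = length hs
  body = λ t → when (c + sum t ≡ᵇ N') (+ binomials t (suc h ∷ hs) ⊗ g t)
  X = when (c + (suc h + sum hs) ≡ᵇ N') (g (suc h ∷ hs))
  rest : ℕ → ℤ
  rest y = ∑ (tuples xs n) (λ t → when ((c + suc y) + sum t ≡ᵇ N') (+ binomials t hs ⊗ g (suc y ∷ t)))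
  factor : ∀ y → ∑ (tuples xs n) (λ t → body (suc y ∷ t)) ≡ + (y C h) ⊗ rest y
  factor y = trans (∑-cong (tuples xs n) (λ t → trans (cong (λ z → when (z ≡ᵇ N') (+ ((y C h) N.* binomials t hs) ⊗ g (suc y ∷ t))) (sym (NP.+-assoc c (suc y) (sum t))))
                                               (when-* _ (y C h) (binomials t hs) (g (suc y ∷ t)))))
                   (sym (∑-*ˡ (tuples xs n) (+ (y C h)) _))
  firstEntry : ∀ y → 1 ≤ y → ∑ (tuples xs n) (λ t → body (y ∷ t)) ≡ when (y ≡ᵇ suc h) X
  firstEntry (suc y) _ with NP.<-cmp y h
  ... | tri< y<h _ _ = begin
      ∑ (tuples xs n) (λ t → body (suc y ∷ t))
    ≡⟨ factor y ⟩
      + (y C h) ⊗ rest y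
    ≡⟨ cong (λ z → + z ⊗ rest y) (k>n⇒nCk≡0 y<h) ⟩
      + 0
    ≡⟨ cong (λ z → when z X) (sym (≢⇒≡ᵇ-false y h (NP.<⇒≢ y<h))) ⟩
      when (y ≡ᵇ h) X
    ∎
  ... | tri≈ _ refl _ = begin
      ∑ (tuples xs n) (λ t → body (suc y ∷ t))
    ≡⟨ factor y ⟩
      + (y C y) ⊗ rest y
    ≡⟨ cong₂ (λ a b → + a ⊗ b) (nCn≡1 y) (∑-tuples-binomials M hs ph hM (c + suc y) N' (λ t → g (suc y ∷ t)) (subst (N' ≤_) (sym (NP.+-assoc c (suc y) (sum hs))) le)) ⟩
      + 1 ⊗ when ((c + suc y) + sum hs ≡ᵇ N') (g (suc y ∷ hs))
    ≡⟨ trans (ZP.*-identityˡ _) (cong (λ z → when (z ≡ᵇ N') (g (suc y ∷ hs))) (NP.+-assoc c (suc y) (sum hs))) ⟩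
      X
    ≡⟨ cong (λ z → when z X) (sym (≡ᵇ-refl y)) ⟩
      when (y ≡ᵇ y) X
    ∎
  ... | tri> _ _ h<y = begin
      ∑ (tuples xs n) (λ t → body (suc y ∷ t))
    ≡⟨ factor y ⟩
      + (y C h) ⊗ rest y
    ≡⟨ cong (+ (y C h) ⊗_) (∑-tuples-binomials M hs ph hM (c + suc y) N' (λ t → g (suc y ∷ t)) (NP.≤-trans le (NP.<⇒≤ N'<))) ⟩
      + (y C h) ⊗ when ((c + suc y) + sum hs ≡ᵇ N') (g (suc y ∷ hs))
    ≡⟨ cong (λ z → + (y C h) ⊗ when z (g (suc y ∷ hs))) (≢⇒≡ᵇ-false _ N' (λ e → NP.<⇒≢ (NP.≤-<-trans le N'<) (sym e))) ⟩
      + (y C h) ⊗ + 0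
    ≡⟨ ZP.*-zeroʳ (+ (y C h)) ⟩
      + 0
    ≡⟨ cong (λ z → when z X) (sym (≢⇒≡ᵇ-false y h (λ e → NP.<⇒≢ h<y (sym e)))) ⟩
      when (y ≡ᵇ h) X
    ∎
    where
    N'< : c + (suc h + sum hs) < (c + suc y) + sum hs
    N'< = subst (c + (suc h + sum hs) <_) (sym (NP.+-assoc c (suc y) (sum hs))) (NP.+-monoʳ-< c (NP.+-monoˡ-< (sum hs) (s≤s h<y)))

patterns-0 : ∀ ℓ → patterns 0 ℓ ≡ replicate ℓ false ∷ []
patterns-0 zero = refl
patterns-0 (suc ℓ) = cong (map (false ∷_)) (patterns-0 ℓ)

at-replicate : ∀ ℓ → at false (replicate ℓ false) 0 ≡ false
at-replicate zero = refl
at-replicate (suc ℓ) = refl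

module _ {G : Set} where
  lhsValue : List (ℕ × G) → List (ℕ × G) → (IWord G → ℤ) → ℤ
  lhsValue u v f = ∑ (ρ⁻¹ u ⧢ ρ⁻¹ v) (λ w → f (ρ w))

  merge-allFalse : ∀ (v : List (ℕ × G)) → merge (replicate (length v) false) [] v ≡ v
  merge-allFalse [] = refl
  merge-allFalse (y ∷ v) = cong (y ∷_) (merge-allFalse v)

  zip-proj : ∀ (v : List (ℕ × G)) → zip (map proj₁ v) (map proj₂ v) ≡ v
  zip-proj [] = refl
  zip-proj ((s , b) ∷ v) = cong ((s , b) ∷_) (zip-proj v)

  lhs≡rhs-emptyˡ : ∀ v → Positive v → ∀ f M → weight v ≤ M → lhsValue [] v f ≡ rhsValue 0 (length v) [] v f M
  lhs≡rhs-emptyˡ v pv f M le = begin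
      f (ρ (ρ⁻¹ v)) ⊕ + 0
    ≡⟨ cong (λ z → f z ⊕ + 0) (ρ∘ρ⁻¹ v pv) ⟩
      f v ⊕ + 0
    ≡⟨ cong (_⊕ + 0) (sym allFalse) ⟩
      patternValue M ℓ (weight v) [] v f (replicate ℓ false) ⊕ + 0
    ≡⟨ cong (λ L → ∑ L (patternValue M ℓ (weight v) [] v f)) (sym (patterns-0 ℓ)) ⟩
      ∑ (patterns 0 ℓ) (patternValue M ℓ (weight v) [] v f)
    ∎
    where
    open ≡-Reasoning
    ℓ = length v
    xs = map suc (upTo M)
    hs = map proj₁ v
    g : List ℕ → ℤ
    g t = f (zip t (map proj₂ v))
    allFalse : patternValue M ℓ (weight v) [] v f (replicate ℓ false) ≡ f v
    allFalse = begin
        patternValue M ℓ (weight v) [] v f (replicate ℓ false)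
      ≡⟨ ∑-cong (tuples xs ℓ) (λ t → cong₂ (λ c w → when (sum t ≡ᵇ weight v) (+ coeffFrom c (+ 0) t (map proj₁ w) (replicate ℓ false) ⊗ f (zip t (map proj₂ w)))) (at-replicate ℓ) (merge-allFalse v)) ⟩
        ∑ (tuples xs ℓ) (λ t → when (sum t ≡ᵇ weight v) (+ coeffFrom false (+ 0) t hs (replicate ℓ false) ⊗ g t))
      ≡⟨ ∑-cong (tuples xs ℓ) (λ t → cong (λ c → when (sum t ≡ᵇ weight v) (+ c ⊗ g t)) (coeffFrom-noCrossing (+ 0) t hs ℓ (LP.length-map proj₁ v))) ⟩
        ∑ (tuples xs ℓ) (λ t → when (sum t ≡ᵇ weight v) (+ binomials t hs ⊗ g t))
      ≡⟨ cong (λ n → ∑ (tuples xs n) (λ t → when (sum t ≡ᵇ weight v) (+ binomials t hs ⊗ g t))) (sym (LP.length-map proj₁ v)) ⟩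
        ∑ (tuples xs (length hs)) (λ t → when (0 + sum t ≡ᵇ weight v) (+ binomials t hs ⊗ g t))
      ≡⟨ ∑-tuples-binomials M hs (AllP.map⁺ pv) (All.map (λ q → NP.≤-trans q le) (All-≤-sum hs)) 0 (weight v) g NP.≤-refl ⟩
        when (0 + sum hs ≡ᵇ weight v) (g hs)
      ≡⟨ cong (λ z → when z (g hs)) (≡ᵇ-refl (weight v)) ⟩
        f (zip hs (map proj₂ v))
      ≡⟨ cong f (zip-proj v) ⟩
        f v
      ∎
module _ {G : Set} where
  rhsLeading : ℕ → List (ℕ × G) → List (ℕ × G) → (IWord G → ℤ) → ℤ
  rhsLeading M [] v f = + 0
  rhsLeading M (y ∷ u) v f =
    ∑ (patterns (length u) (length v)) (λ es → patternValue M (suc (length u + length v)) (weight (y ∷ u) + weight v) (y ∷ u) v f (true ∷ es))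

  rhsValue-leading : ∀ (y : ℕ × G) u z v f M →
    rhsValue (suc (length u)) (suc (length v)) (y ∷ u) (z ∷ v) f M ≡ rhsLeading M (y ∷ u) (z ∷ v) f ⊕ rhsLeading M (z ∷ v) (y ∷ u) f
  rhsValue-leading y u z v f M = begin
      ∑ (map (true ∷_) (patterns lu (suc lv)) ++ map (false ∷_) (patterns (suc lu) lv)) P
    ≡⟨ ∑-++ (map (true ∷_) (patterns lu (suc lv))) (map (false ∷_) (patterns (suc lu) lv)) P ⟩
      ∑ (map (true ∷_) (patterns lu (suc lv))) P ⊕ ∑ (map (false ∷_) (patterns (suc lu) lv)) P
    ≡⟨ cong₂ _⊕_ (∑-map (true ∷_) (patterns lu (suc lv)) P) (∑-map (false ∷_) (patterns (suc lu) lv) P) ⟩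
      rhsLeading M (y ∷ u) (z ∷ v) f ⊕ ∑ (patterns (suc lu) lv) (λ es → P (false ∷ es))
    ≡⟨ cong (rhsLeading M (y ∷ u) (z ∷ v) f ⊕_) (∑-patterns-not (suc lu) lv (λ es → P (false ∷ es))) ⟩
      rhsLeading M (y ∷ u) (z ∷ v) f ⊕ ∑ (patterns lv (suc lu)) (λ es → P (map not (true ∷ es)))
    ≡⟨ cong (rhsLeading M (y ∷ u) (z ∷ v) f ⊕_) (∑-cong (patterns lv (suc lu)) (λ es → patternValue-not M (suc lu + suc lv) N (y ∷ u) (z ∷ v) f (true ∷ es))) ⟩
      rhsLeading M (y ∷ u) (z ∷ v) f ⊕ ∑ (patterns lv (suc lu)) (λ es → patternValue M (suc lu + suc lv) N (z ∷ v) (y ∷ u) f (true ∷ es))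
    ≡⟨ cong₂ (λ k N' → rhsLeading M (y ∷ u) (z ∷ v) f ⊕ ∑ (patterns lv (suc lu)) (λ es → patternValue M k N' (z ∷ v) (y ∷ u) f (true ∷ es)))
             (NP.+-comm (suc lu) (suc lv)) (NP.+-comm (weight (y ∷ u)) (weight (z ∷ v))) ⟩
      rhsLeading M (y ∷ u) (z ∷ v) f ⊕ rhsLeading M (z ∷ v) (y ∷ u) f
    ∎
    where
    open ≡-Reasoning
    lu = length u
    lv = length v
    N = weight (y ∷ u) + weight (z ∷ v)
    P = patternValue M (suc lu + suc lv) N (y ∷ u) (z ∷ v) f

module LeadingLeft {G : Set} (m : ℕ) (a : G) (u : List (ℕ × G)) (n : ℕ) (b : G) (v : List (ℕ × G)) (f : IWord G → ℤ) (M : ℕ) where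
  N K : ℕ
  N = suc m + weight u + (suc n + weight v)
  K = length u + suc (length v)

  xs : List ℕ
  xs = map suc (upTo M)

  pats : List (List Bool)
  pats = patterns (length u) (suc (length v))

  v[_] : ℕ → List (ℕ × G)
  v[ i ] = (suc (n ∸ i) , b) ∷ v

  f[_] : ℕ → IWord G → ℤ
  f[ i ] w = f ((suc (m + i) , a) ∷ w)

  termAt : ℕ → List Bool → List ℕ → ℤ
  termAt y es t = when (y + sum t ≡ᵇ N) (+ (((y ∸ 1) C m) N.* coeffFrom true (+ 0 ⊕ (+ y ⊝ + suc m)) t (map proj₁ (merge es u v[ 0 ])) es)
                                       ⊗ f ((y , a) ∷ zip t (map proj₂ (merge es u v[ 0 ]))))

  totalAt : ℕ → ℤ
  totalAt y = ∑ pats (λ es → ∑ (tuples xs K) (termAt y es))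

  rhsLeading-totalAt : rhsLeading M ((suc m , a) ∷ u) ((suc n , b) ∷ v) f ≡ ∑< M (λ j → totalAt (suc j))
  rhsLeading-totalAt = begin
      ∑ pats (λ es → patternValue M (suc K) N ((suc m , a) ∷ u) ((suc n , b) ∷ v) f (true ∷ es))
    ≡⟨ ∑-cong pats (λ es → trans (∑-concatMap (λ y → map (y ∷_) (tuples xs K)) xs _) (∑-cong xs (λ y → ∑-map (y ∷_) (tuples xs K) _))) ⟩
      ∑ pats (λ es → ∑ xs (λ y → ∑ (tuples xs K) (termAt y es)))
    ≡⟨ ∑-swap pats xs (λ es y → ∑ (tuples xs K) (termAt y es)) ⟩
      ∑ xs totalAt
    ≡⟨ trans (∑-map suc (upTo M) totalAt) (∑-applyUpTo id M (totalAt ∘ suc)) ⟩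
      ∑< M (λ j → totalAt (suc j))
    ∎
    where open ≡-Reasoning

  totalAt-below : ∀ j → j < m → totalAt (suc j) ≡ + 0
  totalAt-below j j<m = ∑-zero pats (λ es → ∑-zero (tuples xs K) (λ t →
    trans (cong (λ c → when (suc j + sum t ≡ᵇ N) (+ (c N.* coeffFrom true (+ 0 ⊕ (+ suc j ⊝ + suc m)) t (map proj₁ (merge es u v[ 0 ])) es)
                                                  ⊗ f ((suc j , a) ∷ zip t (map proj₂ (merge es u v[ 0 ]))))) (k>n⇒nCk≡0 j<m))
          (when-zero _)))

  totalAt-above : Positive u → ∀ z → totalAt (suc (m + (suc n + z))) ≡ + 0
  totalAt-above pu z = ∑-zeroᴬ (All-patterns (length u) (suc (length v))) (λ es ce → ∑-zeroᴬ (All-tuples xs K (All-positiveRange M)) (λ t (lt , pt) →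
    trans (cong (λ c → when (suc y + sum t ≡ᵇ N) (+ c ⊗ f ((suc y , a) ∷ zip t (map proj₂ (merge es u v[ 0 ])))))
            (trans (cong (λ D → (y C m) N.* coeffFrom true D t (map proj₁ (merge es u v[ 0 ])) es) deficit)
              (trans (cong ((y C m) N.*_) (coeffFrom-vanishes es u v (suc n) b (suc n + z) t ce (trans lt (sym (Counts-length ce))) pt pu (NP.m≤m+n (suc n) z)))
                     (NP.*-zeroʳ (y C m)))))
          (when-zero _)))
    where
    y = m + (suc n + z)
    deficit : + 0 ⊕ (+ suc y ⊝ + suc m) ≡ + (suc n + z)
    deficit = trans (ZP.+-identityˡ _) (trans (+m-+n≡+[m∸n] (suc y) (suc m) (s≤s (NP.m≤m+n m _))) (cong +_ (NP.m+n∸m≡n m (suc n + z))))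

  totalAt-middle : Positive u → Positive v → ∀ i → i ≤ n → totalAt (suc (m + i)) ≡ + ((m + i) C i) ⊗ rhsValue (length u) (suc (length v)) u v[ i ] f[ i ] M
  totalAt-middle pu pv i i≤n = begin
      totalAt (suc (m + i))
    ≡⟨ ∑-cong pats (λ es → ∑-congᴬ (All-tuples xs K (All-positiveRange M)) (λ t (_ , pt) → termAt-middle es t pt)) ⟩
      ∑ pats (λ es → ∑ (tuples xs K) (λ t → + c ⊗ term es t))
    ≡⟨ ∑-cong pats (λ es → sym (∑-*ˡ (tuples xs K) (+ c) (term es))) ⟩
      ∑ pats (λ es → + c ⊗ patternValue M K Nᵢ u v[ i ] f[ i ] es)
    ≡⟨ sym (∑-*ˡ pats (+ c) (patternValue M K Nᵢ u v[ i ] f[ i ])) ⟩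
      + c ⊗ rhsValue (length u) (suc (length v)) u v[ i ] f[ i ] M
    ∎
    where
    open ≡-Reasoning
    c = (m + i) C i
    Nᵢ = weight u + weight v[ i ]
    hs : List Bool → List ℕ
    hs es = map proj₁ (merge es u v[ i ])
    term : List Bool → List ℕ → ℤ
    term es t = when (sum t ≡ᵇ Nᵢ) (+ coeffFrom (at false es 0) (+ 0) t (hs es) es ⊗ f[ i ] (zip t (map proj₂ (merge es u v[ i ]))))
    total : ∀ t → (suc (m + i) + sum t ≡ᵇ N) ≡ (sum t ≡ᵇ Nᵢ)
    total t = trans (cong (suc (m + i) + sum t ≡ᵇ_) (weights (weight u) (weight v))) (+-≡ᵇ-cancelˡ (suc (m + i)) (sum t) Nᵢ)
      where
      weights : ∀ wu wv → suc m + wu + (suc n + wv) ≡ suc (m + i) + (wu + (suc (n ∸ i) + wv))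
      weights wu wv = trans (cong (λ k → suc m + wu + (suc k + wv)) (sym (NP.m+[n∸m]≡n i≤n))) (lem m i (n ∸ i) wu wv)
        where
        lem : ∀ m i e wu wv → suc m + wu + (suc (i + e) + wv) ≡ suc (m + i) + (wu + (suc e + wv))
        lem = ℕ-Solver.solve-∀
    deficit : + 0 ⊕ (+ suc (m + i) ⊝ + suc m) ≡ + i
    deficit = trans (ZP.+-identityˡ _) (trans (+m-+n≡+[m∸n] (suc (m + i)) (suc m) (s≤s (NP.m≤m+n m i))) (cong +_ (NP.m+n∸m≡n m i)))
    shiftedCoeff : ∀ es t → AllL (1 ≤_) t → coeffFrom true (+ 0 ⊕ (+ suc (m + i) ⊝ + suc m)) t (map proj₁ (merge es u v[ 0 ])) es ≡ coeffFrom (at false es 0) (+ 0) t (hs es) es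
    shiftedCoeff es t pt = begin
        coeffFrom true (+ 0 ⊕ (+ suc (m + i) ⊝ + suc m)) t (map proj₁ (merge es u v[ 0 ])) es
      ≡⟨ cong (λ D → coeffFrom true D t (map proj₁ (merge es u v[ 0 ])) es) deficit ⟩
        coeffFrom true (+ i) t (map proj₁ (merge es u v[ 0 ])) es
      ≡⟨ coeffFrom-shift es u v (suc n) b i (+ i) t (NP.≤-trans i≤n (NP.n≤1+n n)) ⟩
        coeffFrom true (+ i ⊝ + i) t (map proj₁ (merge es u ((suc n ∸ i , b) ∷ v))) es
      ≡⟨ cong₂ (λ D s → coeffFrom true D t (map proj₁ (merge es u ((s , b) ∷ v))) es) (ZP.+-inverseʳ (+ i)) (NP.+-∸-assoc 1 i≤n) ⟩
        coeffFrom true (+ 0) t (hs es) es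
      ≡⟨ coeffFrom-start t (hs es) es pt (positive-heights es u v[ i ] pu (s≤s z≤n ∷ pv)) ⟩
        coeffFrom (at false es 0) (+ 0) t (hs es) es
      ∎
    termAt-middle : ∀ es t → AllL (1 ≤_) t → termAt (suc (m + i)) es t ≡ + c ⊗ term es t
    termAt-middle es t pt = begin
        termAt (suc (m + i)) es t
      ≡⟨ cong₂ (λ c' L → when (suc (m + i) + sum t ≡ᵇ N) (+ (c' N.* coeffFrom true (+ 0 ⊕ (+ suc (m + i) ⊝ + suc m)) t (map proj₁ (merge es u v[ 0 ])) es) ⊗ f ((suc (m + i) , a) ∷ zip t L)))
               (trans (nCk≡nC[n∸k] (NP.m≤m+n m i)) (cong ((m + i) C_) (NP.m+n∸m≡n m i))) (merge-proj₂ es u v (suc n) (suc (n ∸ i)) b) ⟩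
        when (suc (m + i) + sum t ≡ᵇ N) (+ (((m + i) C i) N.* coeffFrom true (+ 0 ⊕ (+ suc (m + i) ⊝ + suc m)) t (map proj₁ (merge es u v[ 0 ])) es) ⊗ f[ i ] (zip t (map proj₂ (merge es u v[ i ]))))
      ≡⟨ cong₂ (λ B d → when B (+ (c N.* d) ⊗ f[ i ] (zip t (map proj₂ (merge es u v[ i ]))))) (total t) (shiftedCoeff es t pt) ⟩
        when (sum t ≡ᵇ Nᵢ) (+ (c N.* coeffFrom (at false es 0) (+ 0) t (hs es) es) ⊗ f[ i ] (zip t (map proj₂ (merge es u v[ i ]))))
      ≡⟨ when-* (sum t ≡ᵇ Nᵢ) c (coeffFrom (at false es 0) (+ 0) t (hs es) es) _ ⟩
        + c ⊗ term es t
      ∎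

  rhsLeading-expansion : Positive u → Positive v → N ≤ M →
    (∀ i → i ≤ n → lhsValue u v[ i ] f[ i ] ≡ rhsValue (length u) (suc (length v)) u v[ i ] f[ i ] M) →
    rhsLeading M ((suc m , a) ∷ u) ((suc n , b) ∷ v) f ≡ ∑< (suc n) (λ i → + ((m + i) C i) ⊗ lhsValue u v[ i ] f[ i ])
  rhsLeading-expansion pu pv N≤M IH = begin
      rhsLeading M ((suc m , a) ∷ u) ((suc n , b) ∷ v) f
    ≡⟨ rhsLeading-totalAt ⟩
      ∑< M (λ j → totalAt (suc j))
    ≡⟨ cong (λ k → ∑< k (λ j → totalAt (suc j))) M-split ⟩
      ∑< (m + (suc n + q)) (λ j → totalAt (suc j))
    ≡⟨ ∑<-split m (suc n + q) (λ j → totalAt (suc j)) ⟩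
      ∑< m (λ j → totalAt (suc j)) ⊕ ∑< (suc n + q) (λ i → totalAt (suc (m + i)))
    ≡⟨ cong₂ _⊕_ (∑<-zero m totalAt-below) (∑<-split (suc n) q (λ i → totalAt (suc (m + i)))) ⟩
      + 0 ⊕ (∑< (suc n) (λ i → totalAt (suc (m + i))) ⊕ ∑< q (λ z → totalAt (suc (m + (suc n + z)))))
    ≡⟨ cong (λ z → + 0 ⊕ (∑< (suc n) (λ i → totalAt (suc (m + i))) ⊕ z)) (∑<-zero q (λ z _ → totalAt-above pu z)) ⟩
      + 0 ⊕ (∑< (suc n) (λ i → totalAt (suc (m + i))) ⊕ + 0)
    ≡⟨ trans (ZP.+-identityˡ _) (ZP.+-identityʳ _) ⟩
      ∑< (suc n) (λ i → totalAt (suc (m + i)))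
    ≡⟨ ∑<-cong (suc n) (λ i i<1+n → trans (totalAt-middle pu pv i (NP.≤-pred i<1+n)) (cong (+ ((m + i) C i) ⊗_) (sym (IH i (NP.≤-pred i<1+n))))) ⟩
      ∑< (suc n) (λ i → + ((m + i) C i) ⊗ lhsValue u v[ i ] f[ i ])
    ∎
    where
    open ≡-Reasoning
    m+1+n≤M : m + suc n ≤ M
    m+1+n≤M = NP.≤-trans (NP.+-mono-≤ (NP.≤-trans (NP.n≤1+n m) (NP.m≤m+n (suc m) (weight u))) (NP.m≤m+n (suc n) (weight v))) N≤M
    q = M ∸ (m + suc n)
    M-split : M ≡ m + (suc n + q)
    M-split = trans (sym (NP.m+[n∸m]≡n m+1+n≤M)) (NP.+-assoc m (suc n) q)

module _ {G : Set} where
  open LeadingRuns (x₀ {G}) using (leftFirst; rightFirst; ∑-⧢-leadingRuns) renaming (z^ to x₀^)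

  leftFirst-ρ : ∀ m (a : G) u n (b : G) v (f : IWord G → ℤ) i →
    leftFirst m n (x a) (ρ⁻¹ u) (x b) (ρ⁻¹ v) (f ∘ ρ) i ≡ lhsValue u ((suc (n ∸ i) , b) ∷ v) (λ w → f ((suc (m + i) , a) ∷ w))
  leftFirst-ρ m a u n b v f i = ∑-cong (ρ⁻¹ u ⧢ (x₀^ (n ∸ i) ++ x b ∷ ρ⁻¹ v)) (λ w → cong f (ρ-block (m + i) a w))

  rightFirst-ρ : ∀ m (a : G) u n (b : G) v (f : IWord G → ℤ) j →
    rightFirst m n (x a) (ρ⁻¹ u) (x b) (ρ⁻¹ v) (f ∘ ρ) j ≡ lhsValue v ((suc (m ∸ j) , a) ∷ u) (λ w → f ((suc (n + j) , b) ∷ w))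
  rightFirst-ρ m a u n b v f j =
    trans (∑-⧢-comm (x₀^ (m ∸ j) ++ x a ∷ ρ⁻¹ u) (ρ⁻¹ v) (λ w → f (ρ (x₀^ (n + j) ++ x b ∷ w))))
          (∑-cong (ρ⁻¹ v ⧢ (x₀^ (m ∸ j) ++ x a ∷ ρ⁻¹ u)) (λ w → cong f (ρ-block (n + j) b w)))

  lhs≡rhs : ∀ fuel (u v : List (ℕ × G)) → length u + length v ≤ fuel → Positive u → Positive v → ∀ f M → weight u + weight v ≤ M →
    lhsValue u v f ≡ rhsValue (length u) (length v) u v f M
  lhs≡rhs fuel [] v _ _ pv f M N≤M = lhs≡rhs-emptyˡ v pv f M N≤M
  lhs≡rhs fuel (y ∷ u) [] _ pu _ f M N≤M = begin
      lhsValue (y ∷ u) [] f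
    ≡⟨ ∑-⧢-comm (ρ⁻¹ (y ∷ u)) [] (f ∘ ρ) ⟩
      lhsValue [] (y ∷ u) f
    ≡⟨ lhs≡rhs-emptyˡ (y ∷ u) pu f M (subst (_≤ M) (NP.+-identityʳ _) N≤M) ⟩
      rhsValue 0 (length (y ∷ u)) [] (y ∷ u) f M
    ≡⟨ rhsValue-comm 0 (length (y ∷ u)) [] (y ∷ u) f M ⟩
      rhsValue (length (y ∷ u)) 0 (y ∷ u) [] f M
    ∎
    where open ≡-Reasoning
  lhs≡rhs (suc fuel) ((suc m , a) ∷ u) ((suc n , b) ∷ v) len≤ (s≤s z≤n ∷ pu) (s≤s z≤n ∷ pv) f M N≤M = begin
      lhsValue ((suc m , a) ∷ u) ((suc n , b) ∷ v) f
    ≡⟨ ∑-⧢-leadingRuns m n (x a) (ρ⁻¹ u) (x b) (ρ⁻¹ v) (f ∘ ρ) ⟩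
      ∑< (suc n) (λ i → + ((m + i) C i) ⊗ leftFirst m n (x a) (ρ⁻¹ u) (x b) (ρ⁻¹ v) (f ∘ ρ) i)
        ⊕ ∑< (suc m) (λ j → + ((n + j) C j) ⊗ rightFirst m n (x a) (ρ⁻¹ u) (x b) (ρ⁻¹ v) (f ∘ ρ) j)
    ≡⟨ cong₂ _⊕_ (∑<-cong (suc n) (λ i _ → cong (+ ((m + i) C i) ⊗_) (leftFirst-ρ m a u n b v f i)))
                  (∑<-cong (suc m) (λ j _ → cong (+ ((n + j) C j) ⊗_) (rightFirst-ρ m a u n b v f j))) ⟩
      ∑< (suc n) (λ i → + ((m + i) C i) ⊗ lhsValue u (Lft.v[ i ]) (Lft.f[ i ])) ⊕ ∑< (suc m) (λ j → + ((n + j) C j) ⊗ lhsValue v (Rgt.v[ j ]) (Rgt.f[ j ]))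
    ≡⟨ sym (cong₂ _⊕_ (Lft.rhsLeading-expansion pu pv N≤M IHˡ) (Rgt.rhsLeading-expansion pv pu N≤M' IHʳ)) ⟩
      rhsLeading M ((suc m , a) ∷ u) ((suc n , b) ∷ v) f ⊕ rhsLeading M ((suc n , b) ∷ v) ((suc m , a) ∷ u) f
    ≡⟨ sym (rhsValue-leading (suc m , a) u (suc n , b) v f M) ⟩
      rhsValue (suc (length u)) (suc (length v)) ((suc m , a) ∷ u) ((suc n , b) ∷ v) f M
    ∎
    where
    open ≡-Reasoning
    module Lft = LeadingLeft m a u n b v f M
    module Rgt = LeadingLeft n b v m a u f M
    N≤M' : Rgt.N ≤ M
    N≤M' = subst (_≤ M) (NP.+-comm (suc m + weight u) (suc n + weight v)) N≤M
    lenˡ : length u + suc (length v) ≤ fuel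
    lenˡ = NP.≤-pred len≤
    lenʳ : length v + suc (length u) ≤ fuel
    lenʳ = subst (_≤ fuel) (trans (NP.+-suc (length u) (length v)) (trans (cong suc (NP.+-comm (length u) (length v))) (sym (NP.+-suc (length v) (length u))))) lenˡ
    IHˡ : ∀ i → i ≤ n → lhsValue u Lft.v[ i ] Lft.f[ i ] ≡ rhsValue (length u) (suc (length v)) u Lft.v[ i ] Lft.f[ i ] M
    IHˡ i i≤n = lhs≡rhs fuel u Lft.v[ i ] lenˡ pu (s≤s z≤n ∷ pv) Lft.f[ i ] M
      (NP.≤-trans (NP.+-mono-≤ (NP.m≤n+m (weight u) (suc m)) (NP.+-monoˡ-≤ (weight v) (s≤s (NP.m∸n≤m n i)))) N≤M)
    IHʳ : ∀ j → j ≤ m → lhsValue v Rgt.v[ j ] Rgt.f[ j ] ≡ rhsValue (length v) (suc (length u)) v Rgt.v[ j ] Rgt.f[ j ] M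
    IHʳ j j≤m = lhs≡rhs fuel v Rgt.v[ j ] lenʳ pv (s≤s z≤n ∷ pu) Rgt.f[ j ] M
      (NP.≤-trans (NP.+-mono-≤ (NP.m≤n+m (weight v) (suc n)) (NP.+-monoˡ-≤ (weight u) (s≤s (NP.m∸n≤m m j)))) N≤M')
-- Shuffles as position sets

applyUpTo-cong : ∀ {A : Set} {f g : ℕ → A} n → (∀ i → f i ≡ g i) → applyUpTo f n ≡ applyUpTo g n
applyUpTo-cong zero e = refl
applyUpTo-cong (suc n) e = cong₂ _∷_ (e 0) (applyUpTo-cong n (λ i → e (suc i)))

is-just-map : ∀ {A B : Set} (g : A → B) (m : Maybe A) → is-just (Mb.map g m) ≡ is-just m
is-just-map g (just y) = refl
is-just-map g nothing = refl

true≢false : true ≢ false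
true≢false ()

-- A pair (φ, ψ) is handled through the lists of its values in ℕ; the pairs in I_{k,ℓ}
-- are exactly those of the form (truePositions 0 es, falsePositions 0 es) for a sign word es.
indexIn : List ℕ → ℕ → Maybe ℕ
indexIn [] i = nothing
indexIn (j ∷ L) i = if j ≡ᵇ i then just 0 else Mb.map suc (indexIn L i)

memberᵇ : List ℕ → ℕ → Bool
memberᵇ L i = is-just (indexIn L i)

truePositions : ℕ → List Bool → List ℕ
truePositions c [] = []
truePositions c (true ∷ es) = c ∷ truePositions (suc c) es
truePositions c (false ∷ es) = truePositions (suc c) es

falsePositions : ℕ → List Bool → List ℕ
falsePositions c es = truePositions c (map not es)

interval : ℕ → ℕ → List ℕ
interval c zero = []
interval c (suc m) = c ∷ interval (suc c) m

increasingᵇ : List ℕ → Bool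
increasingᵇ [] = true
increasingᵇ (i ∷ []) = true
increasingᵇ (i ∷ j ∷ L) = (i <ᵇ j) ∧ increasingᵇ (j ∷ L)

validPairᵇ : ℕ → List ℕ → List ℕ → Bool
validPairᵇ n Lφ Lψ = increasingᵇ Lφ ∧ increasingᵇ Lψ ∧ allB (λ i → memberᵇ Lφ i xor memberᵇ Lψ i) (upTo n)

membershipBits : ℕ → List ℕ → List Bool
membershipBits n L = map (memberᵇ L) (upTo n)

eqᴺ : List ℕ → List ℕ → Bool
eqᴺ [] [] = true
eqᴺ (y ∷ L) (z ∷ M) = (y ≡ᵇ z) ∧ eqᴺ L M
eqᴺ _ _ = false

eqᴮ : List Bool → List Bool → Bool
eqᴮ [] [] = true
eqᴮ (e ∷ L) (d ∷ M) = not (e xor d) ∧ eqᴮ L M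
eqᴮ _ _ = false

≡ᵇ-sound : ∀ m n → (m ≡ᵇ n) ≡ true → m ≡ n
≡ᵇ-sound m n e = NP.≡ᵇ⇒≡ m n (subst T (sym e) tt)

eqᴺ-sound : ∀ L M → eqᴺ L M ≡ true → L ≡ M
eqᴺ-sound [] [] e = refl
eqᴺ-sound (y ∷ L) (z ∷ M) e with y ≡ᵇ z in eq
... | true = cong₂ _∷_ (≡ᵇ-sound y z eq) (eqᴺ-sound L M e)
eqᴺ-sound [] (z ∷ M) ()
eqᴺ-sound (y ∷ L) [] ()

eqᴺ-refl : ∀ L → eqᴺ L L ≡ true
eqᴺ-refl [] = refl
eqᴺ-refl (y ∷ L) rewrite ≡ᵇ-refl y = eqᴺ-refl L

eqᴮ-sound : ∀ L M → eqᴮ L M ≡ true → L ≡ M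
eqᴮ-sound [] [] e = refl
eqᴮ-sound (true ∷ L) (true ∷ M) e = cong (true ∷_) (eqᴮ-sound L M e)
eqᴮ-sound (false ∷ L) (false ∷ M) e = cong (false ∷_) (eqᴮ-sound L M e)
eqᴮ-sound (true ∷ L) (false ∷ M) ()
eqᴮ-sound (false ∷ L) (true ∷ M) ()
eqᴮ-sound [] (d ∷ M) ()
eqᴮ-sound (e ∷ L) [] ()

eqᴮ-refl : ∀ L → eqᴮ L L ≡ true
eqᴮ-refl [] = refl
eqᴮ-refl (true ∷ L) = eqᴮ-refl L
eqᴮ-refl (false ∷ L) = eqᴮ-refl L

memberᵇ-head : ∀ c L → memberᵇ (c ∷ L) c ≡ true
memberᵇ-head c L rewrite ≡ᵇ-refl c = refl

memberᵇ-skip : ∀ c L i → c < i → memberᵇ (c ∷ L) i ≡ memberᵇ L i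
memberᵇ-skip c L i c<i rewrite ≢⇒≡ᵇ-false c i (NP.<⇒≢ c<i) = is-just-map suc (indexIn L i)

indexIn-absent : ∀ c L → AllL (c <_) L → indexIn L c ≡ nothing
indexIn-absent c [] [] = refl
indexIn-absent c (j ∷ L) (c<j ∷ ps) rewrite ≢⇒≡ᵇ-false j c (λ e → NP.<⇒≢ c<j (sym e)) | indexIn-absent c L ps = refl

memberᵇ-absent : ∀ c L → AllL (c <_) L → memberᵇ L c ≡ false
memberᵇ-absent c L ps rewrite indexIn-absent c L ps = refl

truePositions-bounds : ∀ c es → AllL (λ i → c ≤ i × i < c + length es) (truePositions c es)
truePositions-bounds c [] = []
truePositions-bounds c (true ∷ es) = (NP.≤-refl , subst (c <_) (sym (NP.+-suc c (length es))) (s≤s (NP.m≤m+n c (length es))))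
  ∷ All.map (λ {i} (p , q) → NP.≤-trans (NP.n≤1+n c) p , subst (i <_) (sym (NP.+-suc c (length es))) q) (truePositions-bounds (suc c) es)
truePositions-bounds c (false ∷ es) = All.map (λ {i} (p , q) → NP.≤-trans (NP.n≤1+n c) p , subst (i <_) (sym (NP.+-suc c (length es))) q) (truePositions-bounds (suc c) es)

truePositions-above : ∀ c es → AllL (c <_) (truePositions (suc c) es)
truePositions-above c es = All.map proj₁ (truePositions-bounds (suc c) es)

interval-lower : ∀ c m → AllL (c ≤_) (interval c m)
interval-lower c zero = []
interval-lower c (suc m) = NP.≤-refl ∷ All.map (NP.≤-trans (NP.n≤1+n c)) (interval-lower (suc c) m)

map-congᴬ : ∀ {A B : Set} {P : A → Set} {f g : A → B} (xs : List A) → AllL P xs → (∀ y → P y → f y ≡ g y) → map f xs ≡ map g xs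
map-congᴬ [] [] e = refl
map-congᴬ (y ∷ xs) (p ∷ ps) e = cong₂ _∷_ (e y p) (map-congᴬ xs ps e)

membershipBits-truePositions : ∀ c es → map (memberᵇ (truePositions c es)) (interval c (length es)) ≡ es
membershipBits-truePositions c [] = refl
membershipBits-truePositions c (true ∷ es) = cong₂ _∷_ (memberᵇ-head c (truePositions (suc c) es))
  (trans (map-congᴬ (interval (suc c) (length es)) (interval-lower (suc c) (length es)) (λ i c<i → memberᵇ-skip c (truePositions (suc c) es) i c<i)) (membershipBits-truePositions (suc c) es))
membershipBits-truePositions c (false ∷ es) = cong₂ _∷_ (memberᵇ-absent c (truePositions (suc c) es) (truePositions-above c es)) (membershipBits-truePositions (suc c) es)

upTo≡interval : ∀ n → upTo n ≡ interval 0 n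
upTo≡interval n = go 0 n
  where
  go : ∀ c n → applyUpTo (λ i → c + i) n ≡ interval c n
  go c zero = refl
  go c (suc n) = cong₂ _∷_ (NP.+-identityʳ c) (trans (applyUpTo-cong n (λ i → NP.+-suc c i)) (go (suc c) n))

increasing-∷ : ∀ y L → AllL (y <_) L → increasingᵇ L ≡ true → increasingᵇ (y ∷ L) ≡ true
increasing-∷ y [] ps s = refl
increasing-∷ y (z ∷ L) (y<z ∷ ps) s with y <ᵇ z in eq
... | true = s
... | false = ⊥-elim (subst T eq (NP.<⇒<ᵇ y<z))

increasing-truePositions : ∀ c es → increasingᵇ (truePositions c es) ≡ true
increasing-truePositions c [] = refl
increasing-truePositions c (true ∷ es) = increasing-∷ c (truePositions (suc c) es) (truePositions-above c es) (increasing-truePositions (suc c) es)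
increasing-truePositions c (false ∷ es) = increasing-truePositions (suc c) es

all-xor : ∀ (L : List ℕ) g h es → map g L ≡ es → map h L ≡ map not es → allB (λ i → g i xor h i) L ≡ true
all-xor [] g h [] e1 e2 = refl
all-xor (i ∷ L) g h (true ∷ es) e1 e2 with g i | h i | LP.∷-injective e1 | LP.∷-injective e2
... | .true | .false | refl , e₁ | refl , e₂ = all-xor L g h es e₁ e₂
all-xor (i ∷ L) g h (false ∷ es) e1 e2 with g i | h i | LP.∷-injective e1 | LP.∷-injective e2
... | .false | .true | refl , e₁ | refl , e₂ = all-xor L g h es e₁ e₂

valid-truePositions : ∀ es → validPairᵇ (length es) (truePositions 0 es) (falsePositions 0 es) ≡ true
valid-truePositions es rewrite increasing-truePositions 0 es | increasing-truePositions 0 (map not es) | upTo≡interval (length es) =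
  all-xor (interval 0 (length es)) (memberᵇ (truePositions 0 es)) (memberᵇ (falsePositions 0 es)) es (membershipBits-truePositions 0 es)
    (trans (cong (λ n → map (memberᵇ (falsePositions 0 es)) (interval 0 n)) (sym (LP.length-map not es))) (membershipBits-truePositions 0 (map not es)))

Counts-truePositions : ∀ c es → Counts es (length (truePositions c es)) (length (truePositions c (map not es)))
Counts-truePositions c [] = c[]
Counts-truePositions c (true ∷ es) = cᵗ (Counts-truePositions (suc c) es)
Counts-truePositions c (false ∷ es) = cᶠ (Counts-truePositions (suc c) es)

length-truePositions : ∀ {es k ℓ} c → Counts es k ℓ → length (truePositions c es) ≡ k × length (truePositions c (map not es)) ≡ ℓ
length-truePositions c c[] = refl , refl
length-truePositions c (cᵗ ce) = let (a , b) = length-truePositions (suc c) ce in cong suc a , b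
length-truePositions c (cᶠ ce) = let (a , b) = length-truePositions (suc c) ce in a , cong suc b

∧-split : ∀ a b → a ∧ b ≡ true → a ≡ true × b ≡ true
∧-split true b e = refl , e

increasing-head : ∀ y L → increasingᵇ (y ∷ L) ≡ true → AllL (y <_) L
increasing-head y [] s = []
increasing-head y (z ∷ L) s with ∧-split (y <ᵇ z) (increasingᵇ (z ∷ L)) s
... | e1 , e2 = y<z ∷ All.map (λ {w} z<w → NP.<-trans y<z z<w) (increasing-head z L e2)
  where y<z = NP.<ᵇ⇒< y z (subst T (sym e1) tt)

increasing-tail : ∀ y L → increasingᵇ (y ∷ L) ≡ true → increasingᵇ L ≡ true
increasing-tail y [] s = refl
increasing-tail y (z ∷ L) s = proj₂ (∧-split (y <ᵇ z) (increasingᵇ (z ∷ L)) s)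

truePositions-membershipBits : ∀ m c L → increasingᵇ L ≡ true → AllL (λ i → c ≤ i × i < c + m) L → truePositions c (map (memberᵇ L) (interval c m)) ≡ L
truePositions-membershipBits zero c [] s bd = refl
truePositions-membershipBits zero c (i ∷ L) s ((c≤i , i<c) ∷ bd) = ⊥-elim (NP.<-irrefl refl (NP.≤-<-trans c≤i (subst (i <_) (NP.+-identityʳ c) i<c)))
truePositions-membershipBits (suc m) c [] s bd = truePositions-membershipBits m (suc c) [] refl []
truePositions-membershipBits (suc m) c (j ∷ L) s ((c≤j , j<) ∷ bd) with j ≡ᵇ c in ejc
... | true with ≡ᵇ-sound j c ejc
...   | refl = cong (c ∷_) (trans (cong (truePositions (suc c)) (map-congᴬ (interval (suc c) m) (interval-lower (suc c) m) (λ i c<i → memberᵇ-skip c L i c<i)))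
                   (truePositions-membershipBits m (suc c) L (increasing-tail c L s)
                     (All.zipWith (λ {i} (c<i , (_ , i<)) → c<i , subst (i <_) (NP.+-suc c m) i<) (increasing-head c L s , bd))))
truePositions-membershipBits (suc m) c (j ∷ L) s ((c≤j , j<) ∷ bd) | false =
  trans (cong (λ b → truePositions c (b ∷ map (memberᵇ (j ∷ L)) (interval (suc c) m))) mfalse)
        (truePositions-membershipBits m (suc c) (j ∷ L) s ((c<j , subst (j <_) (NP.+-suc c m) j<) ∷ All.zipWith (λ {i} (j<i , (_ , i<)) → NP.<-trans c<j j<i , subst (i <_) (NP.+-suc c m) i<) (increasing-head j L s , bd)))
  where
  c<j : c < j
  c<j = NP.≤∧≢⇒< c≤j (λ e → true≢false (trans (sym (≡ᵇ-refl c)) (subst (λ z → (z ≡ᵇ c) ≡ false) (sym e) ejc)))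
  mfalse : is-just (Mb.map suc (indexIn L c)) ≡ false
  mfalse = trans (is-just-map suc (indexIn L c)) (memberᵇ-absent c L (All.map (λ {i} j<i → NP.<-trans c<j j<i) (increasing-head j L s)))

all-xor⇒not : ∀ (L : List ℕ) g h → allB (λ i → g i xor h i) L ≡ true → map not (map g L) ≡ map h L
all-xor⇒not [] g h e = refl
all-xor⇒not (i ∷ L) g h e with g i | h i | ∧-split (g i xor h i) (allB (λ i → g i xor h i) L) e
... | true | false | _ , e2 = cong (false ∷_) (all-xor⇒not L g h e2)
... | false | true | _ , e2 = cong (true ∷_) (all-xor⇒not L g h e2)
... | true | true | () , _
... | false | false | () , _

validPair-positions : ∀ n Lφ Lψ → validPairᵇ n Lφ Lψ ≡ true → AllL (_< n) Lφ → AllL (_< n) Lψ →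
  truePositions 0 (membershipBits n Lφ) ≡ Lφ × falsePositions 0 (membershipBits n Lφ) ≡ Lψ
validPair-positions n Lφ Lψ ev bφ bψ with ∧-split (increasingᵇ Lφ) _ ev
... | s1 , ev2 with ∧-split (increasingᵇ Lψ) _ ev2
... | s2 , ev3 =
  trans (cong (λ L → truePositions 0 (map (memberᵇ Lφ) L)) (upTo≡interval n)) (truePositions-membershipBits n 0 Lφ s1 (All.map (λ i<n → z≤n , i<n) bφ)) ,
  trans (cong (truePositions 0) (trans (all-xor⇒not (upTo n) (memberᵇ Lφ) (memberᵇ Lψ) ev3) (cong (map (memberᵇ Lψ)) (upTo≡interval n))))
        (truePositions-membershipBits n 0 Lψ s2 (All.map (λ i<n → z≤n , i<n) bψ))

Counts-membershipBits : ∀ n k ℓ Lφ Lψ → validPairᵇ n Lφ Lψ ≡ true → AllL (_< n) Lφ → AllL (_< n) Lψ → length Lφ ≡ k → length Lψ ≡ ℓ →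
  Counts (membershipBits n Lφ) k ℓ
Counts-membershipBits n k ℓ Lφ Lψ ev bφ bψ lφ lψ with validPair-positions n Lφ Lψ ev bφ bψ
... | e1 , e2 = subst₂ (Counts (membershipBits n Lφ)) (trans (cong length e1) lφ) (trans (cong length e2) lψ) (Counts-truePositions 0 (membershipBits n Lφ))

∑-patterns-delta : ∀ {c k ℓ} → Counts c k ℓ → ∀ X → ∑ (patterns k ℓ) (λ es → when (eqᴮ es c) X) ≡ X
∑-patterns-delta c[] X = ZP.+-identityʳ X
∑-patterns-delta {true ∷ c} {suc k} {zero} (cᵗ ce) X = trans (∑-map (true ∷_) (patterns k zero) _) (∑-patterns-delta ce X)
∑-patterns-delta {true ∷ c} {suc k} {suc ℓ} (cᵗ ce) X =
  trans (∑-++ (map (true ∷_) (patterns k (suc ℓ))) (map (false ∷_) (patterns (suc k) ℓ)) _)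
    (trans (cong₂ _⊕_ (trans (∑-map (true ∷_) (patterns k (suc ℓ)) _) (∑-patterns-delta ce X))
                     (trans (∑-map (false ∷_) (patterns (suc k) ℓ) _) (∑-zero (patterns (suc k) ℓ) (λ _ → refl))))
           (ZP.+-identityʳ X))
∑-patterns-delta {false ∷ c} {zero} {suc ℓ} (cᶠ ce) X = trans (∑-map (false ∷_) (patterns zero ℓ) _) (∑-patterns-delta ce X)
∑-patterns-delta {false ∷ c} {suc k} {suc ℓ} (cᶠ ce) X =
  trans (∑-++ (map (true ∷_) (patterns k (suc ℓ))) (map (false ∷_) (patterns (suc k) ℓ)) _)
    (trans (cong₂ _⊕_ (trans (∑-map (true ∷_) (patterns k (suc ℓ)) _) (∑-zero (patterns k (suc ℓ)) (λ _ → refl)))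
                     (trans (∑-map (false ∷_) (patterns (suc k) ℓ) _) (∑-patterns-delta ce X)))
           (ZP.+-identityˡ X))


∑-tuples-delta : ∀ n m c (h : List ℕ → ℤ) → length c ≡ m → AllL (_< n) c → ∑ (tuples (upTo n) m) (λ L → when (eqᴺ L c) (h L)) ≡ h c
∑-tuples-delta n zero [] h lc bc = ZP.+-identityʳ (h [])
∑-tuples-delta n (suc m) (c0 ∷ c) h lc (c0<n ∷ bc) = begin
    ∑ (concatMap (λ y → map (y ∷_) (tuples xs m)) xs) (λ L → when (eqᴺ L (c0 ∷ c)) (h L))
  ≡⟨ ∑-concatMap (λ y → map (y ∷_) (tuples xs m)) xs (λ L → when (eqᴺ L (c0 ∷ c)) (h L)) ⟩
    ∑ xs (λ y → ∑ (map (y ∷_) (tuples xs m)) (λ L → when (eqᴺ L (c0 ∷ c)) (h L)))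
  ≡⟨ ∑-cong xs (λ y → trans (∑-map (y ∷_) (tuples xs m) (λ L → when (eqᴺ L (c0 ∷ c)) (h L))) (trans (sym (when-∑-∧ (y ≡ᵇ c0) (tuples xs m) (λ L → eqᴺ L c) (λ L → h (y ∷ L))))
        (cong (when (y ≡ᵇ c0)) (∑-tuples-delta n m c (λ L → h (y ∷ L)) (NP.suc-injective lc) bc)))) ⟩
    ∑ xs (λ y → when (y ≡ᵇ c0) (h (y ∷ c)))
  ≡⟨ ∑-applyUpTo id n (λ y → when (y ≡ᵇ c0) (h (y ∷ c))) ⟩
    ∑< n (λ y → when (y ≡ᵇ c0) (h (y ∷ c)))
  ≡⟨ ∑<-delta n c0 (λ y → h (y ∷ c)) c0<n ⟩
    h (c0 ∷ c)
  ∎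
  where
  open ≡-Reasoning
  xs = upTo n
  when-∑-∧ : ∀ {A : Set} b (L : List A) (q : A → Bool) (H : A → ℤ) → when b (∑ L (λ z → when (q z) (H z))) ≡ ∑ L (λ z → when (b ∧ q z) (H z))
  when-∑-∧ true L q H = refl
  when-∑-∧ false L q H = sym (∑-zero L (λ _ → refl))

membershipBits∘truePositions : ∀ n es → length es ≡ n → membershipBits n (truePositions 0 es) ≡ es
membershipBits∘truePositions n es le = trans (cong (map (memberᵇ (truePositions 0 es))) (trans (upTo≡interval n) (cong (interval 0) (sym le)))) (membershipBits-truePositions 0 es)

-- A valid pair arises from exactly one sign word, namely its membership bits.
∑-patterns-matching : ∀ k ℓ Lφ Lψ → length Lφ ≡ k → AllL (_< k + ℓ) Lφ → length Lψ ≡ ℓ → AllL (_< k + ℓ) Lψ → ∀ X →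
  ∑ (patterns k ℓ) (λ es → when (eqᴺ Lφ (truePositions 0 es)) (when (eqᴺ Lψ (falsePositions 0 es)) X)) ≡ when (validPairᵇ (k + ℓ) Lφ Lψ) X
∑-patterns-matching k ℓ Lφ Lψ lφ bφ lψ bψ X with validPairᵇ (k + ℓ) Lφ Lψ in ev
... | true = trans (∑-congᴬ (All-patterns k ℓ) matching) (∑-patterns-delta (Counts-membershipBits (k + ℓ) k ℓ Lφ Lψ ev bφ bψ lφ lψ) X)
  where
  positions = validPair-positions (k + ℓ) Lφ Lψ ev bφ bψ
  matching : ∀ es → Counts es k ℓ → when (eqᴺ Lφ (truePositions 0 es)) (when (eqᴺ Lψ (falsePositions 0 es)) X) ≡ when (eqᴮ es (membershipBits (k + ℓ) Lφ)) X
  matching es ce with eqᴮ es (membershipBits (k + ℓ) Lφ) in e1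
  ... | true with eqᴮ-sound es (membershipBits (k + ℓ) Lφ) e1
  ...   | refl rewrite proj₁ positions | proj₂ positions | eqᴺ-refl Lφ | eqᴺ-refl Lψ = refl
  matching es ce | false with eqᴺ Lφ (truePositions 0 es) in e2
  ... | true = ⊥-elim (true≢false (trans (sym (eqᴮ-refl es)) (trans (cong (eqᴮ es) (sym esq)) e1)))
    where
    esq : membershipBits (k + ℓ) Lφ ≡ es
    esq = trans (cong (membershipBits (k + ℓ)) (eqᴺ-sound Lφ (truePositions 0 es) e2)) (membershipBits∘truePositions (k + ℓ) es (Counts-length ce))
  ... | false = refl
... | false = ∑-zeroᴬ (All-patterns k ℓ) unmatched
  where
  unmatched : ∀ es → Counts es k ℓ → when (eqᴺ Lφ (truePositions 0 es)) (when (eqᴺ Lψ (falsePositions 0 es)) X) ≡ + 0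
  unmatched es ce with eqᴺ Lφ (truePositions 0 es) in e1 | eqᴺ Lψ (falsePositions 0 es) in e2
  ... | true | true = ⊥-elim (true≢false (trans (sym vp) ev))
    where
    vp : validPairᵇ (k + ℓ) Lφ Lψ ≡ true
    vp rewrite eqᴺ-sound Lφ (truePositions 0 es) e1 | eqᴺ-sound Lψ (falsePositions 0 es) e2 | sym (Counts-length ce) = valid-truePositions es
  ... | true | false = refl
  ... | false | _ = refl

∑-validPairs≡∑-patterns : ∀ k ℓ (g : List ℕ → List ℕ → ℤ) →
  ∑ (tuples (upTo (k + ℓ)) k) (λ Lφ → ∑ (tuples (upTo (k + ℓ)) ℓ) (λ Lψ → when (validPairᵇ (k + ℓ) Lφ Lψ) (g Lφ Lψ)))
  ≡ ∑ (patterns k ℓ) (λ es → g (truePositions 0 es) (falsePositions 0 es))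
∑-validPairs≡∑-patterns k ℓ g = sym (begin
    ∑ pats (λ es → g (trueP es) (falseP es))
  ≡⟨ ∑-congᴬ (All-patterns k ℓ) (λ es ce → sym (trans (∑-tuples-delta n k (trueP es) (λ Lφ → ∑ tuplesψ (λ Lψ → when (eqᴺ Lψ (falseP es)) (g Lφ Lψ))) (proj₁ (length-truePositions 0 ce)) (trueP-bounded es ce))
                                                (∑-tuples-delta n ℓ (falseP es) (g (trueP es)) (proj₂ (length-truePositions 0 ce)) (falseP-bounded es ce)))) ⟩
    ∑ pats (λ es → ∑ tuplesφ (λ Lφ → when (eqᴺ Lφ (trueP es)) (∑ tuplesψ (λ Lψ → when (eqᴺ Lψ (falseP es)) (g Lφ Lψ)))))
  ≡⟨ ∑-swap pats tuplesφ (λ es Lφ → when (eqᴺ Lφ (trueP es)) (∑ tuplesψ (λ Lψ → when (eqᴺ Lψ (falseP es)) (g Lφ Lψ)))) ⟩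
    ∑ tuplesφ (λ Lφ → ∑ pats (λ es → when (eqᴺ Lφ (trueP es)) (∑ tuplesψ (λ Lψ → when (eqᴺ Lψ (falseP es)) (g Lφ Lψ)))))
  ≡⟨ ∑-cong tuplesφ (λ Lφ → trans (∑-cong pats (λ es → when-∑ (eqᴺ Lφ (trueP es)) tuplesψ (λ Lψ → when (eqᴺ Lψ (falseP es)) (g Lφ Lψ))))
                                (∑-swap pats tuplesψ (λ es Lψ → when (eqᴺ Lφ (trueP es)) (when (eqᴺ Lψ (falseP es)) (g Lφ Lψ))))) ⟩
    ∑ tuplesφ (λ Lφ → ∑ tuplesψ (λ Lψ → ∑ pats (λ es → when (eqᴺ Lφ (trueP es)) (when (eqᴺ Lψ (falseP es)) (g Lφ Lψ)))))
  ≡⟨ ∑-congᴬ (All-tuples (upTo n) k (AllP.all-upTo n)) (λ Lφ (lφ , bφ) → ∑-congᴬ (All-tuples (upTo n) ℓ (AllP.all-upTo n)) (λ Lψ (lψ , bψ) → ∑-patterns-matching k ℓ Lφ Lψ lφ bφ lψ bψ (g Lφ Lψ))) ⟩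
    ∑ tuplesφ (λ Lφ → ∑ tuplesψ (λ Lψ → when (validPairᵇ n Lφ Lψ) (g Lφ Lψ)))
  ∎)
  where
  open ≡-Reasoning
  n = k + ℓ
  pats = patterns k ℓ
  tuplesφ = tuples (upTo n) k
  tuplesψ = tuples (upTo n) ℓ
  trueP = truePositions 0
  falseP = falsePositions 0
  trueP-bounded : ∀ es → Counts es k ℓ → AllL (_< n) (trueP es)
  trueP-bounded es ce = All.map (λ {i} (_ , lt) → subst (i <_) (Counts-length ce) lt) (truePositions-bounds 0 es)
  falseP-bounded : ∀ es → Counts es k ℓ → AllL (_< n) (falseP es)
  falseP-bounded es ce = All.map (λ {i} (_ , lt) → subst (i <_) (trans (LP.length-map not es) (Counts-length ce)) lt) (truePositions-bounds 0 (map not es))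

lookupᵐ : ∀ {A : Set} → List A → ℕ → Maybe A
lookupᵐ [] _ = nothing
lookupᵐ (y ∷ ys) zero = just y
lookupᵐ (y ∷ ys) (suc j) = lookupᵐ ys j

interleaveᵐ : ∀ {A : Set} → Maybe ℕ → Maybe ℕ → List A → List A → Maybe A
interleaveᵐ (just j) q xs ys = lookupᵐ xs j
interleaveᵐ nothing (just j) xs ys = lookupᵐ ys j
interleaveᵐ nothing nothing xs ys = nothing

interleaveAtᴺ : ∀ {A : Set} → List ℕ → List ℕ → List A → List A → ℕ → Maybe A
interleaveAtᴺ Lφ Lψ xs ys i = interleaveᵐ (indexIn Lφ i) (indexIn Lψ i) xs ys

module _ {A : Set} where
  interleaveᵐ-sucˡ : ∀ p q (y : A) xs ys → interleaveᵐ (Mb.map suc p) q (y ∷ xs) ys ≡ interleaveᵐ p q xs ys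
  interleaveᵐ-sucˡ (just j) q y xs ys = refl
  interleaveᵐ-sucˡ nothing (just j) y xs ys = refl
  interleaveᵐ-sucˡ nothing nothing y xs ys = refl

  interleaveᵐ-sucʳ : ∀ p q xs (y : A) ys → interleaveᵐ p (Mb.map suc q) xs (y ∷ ys) ≡ interleaveᵐ p q xs ys
  interleaveᵐ-sucʳ (just j) q xs y ys = refl
  interleaveᵐ-sucʳ nothing (just j) xs y ys = refl
  interleaveᵐ-sucʳ nothing nothing xs y ys = refl

  interleaveAtᴺ-skipˡ : ∀ c L L' (y : A) xs ys i → c < i → interleaveAtᴺ (c ∷ L) L' (y ∷ xs) ys i ≡ interleaveAtᴺ L L' xs ys i
  interleaveAtᴺ-skipˡ c L L' y xs ys i c<i rewrite ≢⇒≡ᵇ-false c i (NP.<⇒≢ c<i) = interleaveᵐ-sucˡ (indexIn L i) (indexIn L' i) y xs ys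

  interleaveAtᴺ-skipʳ : ∀ c L L' xs (y : A) ys i → c < i → interleaveAtᴺ L (c ∷ L') xs (y ∷ ys) i ≡ interleaveAtᴺ L L' xs ys i
  interleaveAtᴺ-skipʳ c L L' xs y ys i c<i rewrite ≢⇒≡ᵇ-false c i (NP.<⇒≢ c<i) = interleaveᵐ-sucʳ (indexIn L i) (indexIn L' i) xs y ys

  interleaveAtᴺ-positions : ∀ c es (xs ys : List A) → Counts es (length xs) (length ys) →
    map (interleaveAtᴺ (truePositions c es) (falsePositions c es) xs ys) (interval c (length es)) ≡ map just (merge es xs ys)
  interleaveAtᴺ-positions c [] xs ys ce = refl
  interleaveAtᴺ-positions c (true ∷ es) [] ys ()
  interleaveAtᴺ-positions c (true ∷ es) (y ∷ xs) ys (cᵗ ce) = cong₂ _∷_ hd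
    (trans (map-congᴬ (interval (suc c) (length es)) (interval-lower (suc c) (length es)) (λ i c<i → interleaveAtᴺ-skipˡ c (truePositions (suc c) es) (falsePositions (suc c) es) y xs ys i c<i))
           (interleaveAtᴺ-positions (suc c) es xs ys ce))
    where
    hd : interleaveAtᴺ (c ∷ truePositions (suc c) es) (falsePositions (suc c) es) (y ∷ xs) ys c ≡ just y
    hd rewrite ≡ᵇ-refl c = refl
  interleaveAtᴺ-positions c (false ∷ es) xs [] ()
  interleaveAtᴺ-positions c (false ∷ es) xs (y ∷ ys) (cᶠ ce) = cong₂ _∷_ hd
    (trans (map-congᴬ (interval (suc c) (length es)) (interval-lower (suc c) (length es)) (λ i c<i → interleaveAtᴺ-skipʳ c (truePositions (suc c) es) (falsePositions (suc c) es) xs y ys i c<i))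
           (interleaveAtᴺ-positions (suc c) es xs ys ce))
    where
    hd : interleaveAtᴺ (truePositions (suc c) es) (c ∷ falsePositions (suc c) es) xs (y ∷ ys) c ≡ just y
    hd rewrite indexIn-absent c (truePositions (suc c) es) (truePositions-above c es) | ≡ᵇ-refl c = refl

  sequenceMaybe-just : ∀ (L : List A) → sequenceMaybe (map just L) ≡ just L
  sequenceMaybe-just [] = refl
  sequenceMaybe-just (y ∷ L) rewrite sequenceMaybe-just L = refl


toℕs : ∀ {n k} → Vec (Fin n) k → List ℕ
toℕs v = map toℕ (Vec.toList v)

does-Fin-≟ : ∀ {n} (j i : Fin n) → does (j FP.≟ i) ≡ (toℕ j ≡ᵇ toℕ i)
does-Fin-≟ F.zero F.zero = refl
does-Fin-≟ F.zero (F.suc i) = refl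
does-Fin-≟ (F.suc j) F.zero = refl
does-Fin-≟ (F.suc j) (F.suc i) = does-Fin-≟ j i

isYes-Fin-≟ : ∀ {n} (j i : Fin n) → ⌊ j FP.≟ i ⌋ ≡ (toℕ j ≡ᵇ toℕ i)
isYes-Fin-≟ j i = trans (isYes≗does (j FP.≟ i)) (does-Fin-≟ j i)

preimage≡indexIn : ∀ {n k} (v : Vec (Fin n) k) (i : Fin n) → Mb.map toℕ (preimage v i) ≡ indexIn (toℕs v) (toℕ i)
preimage≡indexIn Vec.[] i = refl
preimage≡indexIn (j Vec.∷ v) i rewrite sym (isYes-Fin-≟ j i) | sym (preimage≡indexIn v i) with ⌊ j FP.≟ i ⌋ | preimage v i
... | true | _ = refl
... | false | just m = refl
... | false | nothing = refl

inImage≡memberᵇ : ∀ {n k} (v : Vec (Fin n) k) (i : Fin n) → inImage v i ≡ memberᵇ (toℕs v) (toℕ i)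
inImage≡memberᵇ v i = trans (sym (is-just-map toℕ (preimage v i))) (cong is-just (preimage≡indexIn v i))

lookupᵐ-toList : ∀ {A : Set} {k} (xs : Vec A k) (j : Fin k) → lookupᵐ (Vec.toList xs) (toℕ j) ≡ just (Vec.lookup xs j)
lookupᵐ-toList (y Vec.∷ xs) F.zero = refl
lookupᵐ-toList (y Vec.∷ xs) (F.suc j) = lookupᵐ-toList xs j

interleaveAt≡interleaveAtᴺ : ∀ {A : Set} {n k ℓ} (φ : Vec (Fin n) k) (ψ : Vec (Fin n) ℓ) (xs : Vec A k) (ys : Vec A ℓ) i →
  interleaveAt φ ψ xs ys i ≡ interleaveAtᴺ (toℕs φ) (toℕs ψ) (Vec.toList xs) (Vec.toList ys) (toℕ i)
interleaveAt≡interleaveAtᴺ φ ψ xs ys i rewrite sym (preimage≡indexIn φ i) | sym (preimage≡indexIn ψ i) with preimage φ i | preimage ψ i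
... | just j | _ = sym (lookupᵐ-toList xs j)
... | nothing | just j = sym (lookupᵐ-toList ys j)
... | nothing | nothing = refl

increasing≡increasingᵇ : ∀ {n k} (v : Vec (Fin n) k) → strictlyIncreasing v ≡ increasingᵇ (toℕs v)
increasing≡increasingᵇ Vec.[] = refl
increasing≡increasingᵇ (i Vec.∷ Vec.[]) = refl
increasing≡increasingᵇ (i Vec.∷ (j Vec.∷ v)) = cong ((toℕ i <ᵇ toℕ j) ∧_) (increasing≡increasingᵇ (j Vec.∷ v))

allB-map : ∀ {A B : Set} (P : B → Bool) (g : A → B) xs → allB (λ y → P (g y)) xs ≡ allB P (map g xs)
allB-map P g [] = refl
allB-map P g (y ∷ xs) = cong (P (g y) ∧_) (allB-map P g xs)

allB-cong : ∀ {A : Set} {P Q : A → Bool} xs → (∀ y → P y ≡ Q y) → allB P xs ≡ allB Q xs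
allB-cong [] e = refl
allB-cong (y ∷ xs) e = cong₂ _∧_ (e y) (allB-cong xs e)

tabulate-toℕ : ∀ {A : Set} n (h : ℕ → A) → tabulate {n = n} (λ i → h (toℕ i)) ≡ applyUpTo h n
tabulate-toℕ zero h = refl
tabulate-toℕ (suc n) h = cong (h 0 ∷_) (tabulate-toℕ n (h ∘ suc))

map-toℕ-allFin : ∀ n → map toℕ (allFin n) ≡ upTo n
map-toℕ-allFin n = trans (LP.map-tabulate id toℕ) (tabulate-toℕ n id)

map-allFin : ∀ {A : Set} n (h : Fin n → A) (g : ℕ → A) → (∀ i → h i ≡ g (toℕ i)) → map h (allFin n) ≡ map g (upTo n)
map-allFin n h g e = trans (LP.map-cong e (allFin n)) (trans (LP.map-∘ (allFin n)) (cong (map g) (map-toℕ-allFin n)))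

isShufflePair≡validPairᵇ : ∀ {k ℓ} (φ : Vec (Fin (k + ℓ)) k) (ψ : Vec (Fin (k + ℓ)) ℓ) → isShufflePair φ ψ ≡ validPairᵇ (k + ℓ) (toℕs φ) (toℕs ψ)
isShufflePair≡validPairᵇ {k} {ℓ} φ ψ rewrite increasing≡increasingᵇ φ | increasing≡increasingᵇ ψ =
  cong (λ z → increasingᵇ (toℕs φ) ∧ increasingᵇ (toℕs ψ) ∧ z)
    (trans (allB-cong (allFin (k + ℓ)) (λ i → cong₂ _xor_ (inImage≡memberᵇ φ i) (inImage≡memberᵇ ψ i)))
      (trans (allB-map (λ m → memberᵇ (toℕs φ) m xor memberᵇ (toℕs ψ) m) toℕ (allFin (k + ℓ))) (cong (allB _) (map-toℕ-allFin (k + ℓ)))))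

length-toℕs : ∀ {n k} (v : Vec (Fin n) k) → length (toℕs v) ≡ k
length-toℕs {n} {k} v = trans (LP.length-map toℕ (Vec.toList v)) (VP.length-toList v)

toℕs-bounded : ∀ {n k} (v : Vec (Fin n) k) → AllL (_< n) (toℕs v)
toℕs-bounded Vec.[] = []
toℕs-bounded (i Vec.∷ v) = FP.toℕ<n i ∷ toℕs-bounded v

∑-allVecs-map : ∀ {A : Set} (xs : List A) (g : A → ℕ) k (h : List ℕ → ℤ) → ∑ (allVecs xs k) (λ v → h (map g (Vec.toList v))) ≡ ∑ (tuples (map g xs) k) h
∑-allVecs-map xs g zero h = refl
∑-allVecs-map xs g (suc k) h = begin
    ∑ (concatMap (λ y → map (y Vec.∷_) (allVecs xs k)) xs) (λ v → h (map g (Vec.toList v)))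
  ≡⟨ ∑-concatMap (λ y → map (y Vec.∷_) (allVecs xs k)) xs _ ⟩
    ∑ xs (λ y → ∑ (map (y Vec.∷_) (allVecs xs k)) (λ v → h (map g (Vec.toList v))))
  ≡⟨ ∑-cong xs (λ y → trans (∑-map (y Vec.∷_) (allVecs xs k) _) (∑-allVecs-map xs g k (λ L → h (g y ∷ L)))) ⟩
    ∑ xs (λ y → ∑ (tuples (map g xs) k) (λ L → h (g y ∷ L)))
  ≡⟨ sym (∑-cong xs (λ y → ∑-map (g y ∷_) (tuples (map g xs) k) h)) ⟩
    ∑ xs (λ y → ∑ (map (g y ∷_) (tuples (map g xs) k)) h)
  ≡⟨ sym (∑-map g xs (λ z → ∑ (map (z ∷_) (tuples (map g xs) k)) h)) ⟩
    ∑ (map g xs) (λ z → ∑ (map (z ∷_) (tuples (map g xs) k)) h)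
  ≡⟨ sym (∑-concatMap (λ z → map (z ∷_) (tuples (map g xs) k)) (map g xs) h) ⟩
    ∑ (tuples (map g xs) (suc k)) h
  ∎
  where open ≡-Reasoning

∑-allVecs : ∀ (xs : List ℕ) k (h : List ℕ → ℤ) → ∑ (allVecs xs k) (λ v → h (Vec.toList v)) ≡ ∑ (tuples xs k) h
∑-allVecs xs k h = begin
    ∑ (allVecs xs k) (λ v → h (Vec.toList v))
  ≡⟨ ∑-cong (allVecs xs k) (λ v → cong h (sym (LP.map-id (Vec.toList v)))) ⟩
    ∑ (allVecs xs k) (λ v → h (map id (Vec.toList v)))
  ≡⟨ ∑-allVecs-map xs id k h ⟩
    ∑ (tuples (map id xs) k) h
  ≡⟨ cong (λ ys → ∑ (tuples ys k) h) (LP.map-id xs) ⟩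
    ∑ (tuples xs k) h
  ∎
  where open ≡-Reasoning

sum-toList : ∀ {n} (t : Vec ℕ n) → Vec.sum t ≡ sum (Vec.toList t)
sum-toList Vec.[] = refl
sum-toList (y Vec.∷ t) = cong (λ z → y + z) (sum-toList t)

∑-compositions : ∀ n N (H : List ℕ → ℤ) → ∑ (compositions n N) (λ t → H (Vec.toList t)) ≡ ∑ (tuples (map suc (upTo N)) n) (λ t → when (sum t ≡ᵇ N) (H t))
∑-compositions n N H = trans (∑-filter (λ t → Vec.sum t N.≟ N) (allVecs (map suc (upTo N)) n) (λ t → H (Vec.toList t)))
  (trans (∑-cong (allVecs (map suc (upTo N)) n) (λ t → cong (λ z → when (z ≡ᵇ N) (H (Vec.toList t))) (sum-toList t)))
         (∑-allVecs (map suc (upTo N)) n (λ t → when (sum t ≡ᵇ N) (H t))))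

-- The coefficient c as a running product

coeffAt : Bool → ℤ → List ℕ → List ℕ → List Bool → ℕ → ℕ
coeffAt p D ts hs es zero =
  if not (at false es 0 xor p) then (at 0 ts 0 ∸ 1) C (at 0 hs 0 ∸ 1)
  else binomℤ (at 0 ts 0 ∸ 1) (D ⊕ (+ sum (take 1 ts) ⊝ + sum (take 1 hs)))
coeffAt p D ts hs es (suc j) =
  if not (at false es (suc j) xor at false es j) then (at 0 ts (suc j) ∸ 1) C (at 0 hs (suc j) ∸ 1)
  else binomℤ (at 0 ts (suc j) ∸ 1) (D ⊕ (+ sum (take (suc (suc j)) ts) ⊝ + sum (take (suc (suc j)) hs)))

cAt≡coeffAt : ∀ ts hs es i → cAt ts hs es i ≡ coeffAt (at false es 0) (+ 0) ts hs es i
cAt≡coeffAt ts hs es zero rewrite xor-same (at false es 0) = refl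
cAt≡coeffAt ts hs es (suc j) =
  cong (λ z → if not (at false es (suc j) xor at false es j) then (at 0 ts (suc j) ∸ 1) C (at 0 hs (suc j) ∸ 1) else binomℤ (at 0 ts (suc j) ∸ 1) z)
       (sym (ZP.+-identityˡ (+ sum (take (suc (suc j)) ts) ⊝ + sum (take (suc (suc j)) hs))))

deficit-+ : ∀ D t h y z → D ⊕ (+ (t + y) ⊝ + (h + z)) ≡ (D ⊕ (+ t ⊝ + h)) ⊕ (+ y ⊝ + z)
deficit-+ D t h y z rewrite ZP.pos-+ t y | ZP.pos-+ h z = lem D (+ t) (+ h) (+ y) (+ z)
  where
  lem : ∀ D t h y z → D ⊕ ((t ⊕ y) ⊝ (h ⊕ z)) ≡ (D ⊕ (t ⊝ h)) ⊕ (y ⊝ z)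
  lem = solve-∀

coeffAt-suc : ∀ p D t ts h hs e es j → coeffAt p D (t ∷ ts) (h ∷ hs) (e ∷ es) (suc j) ≡ coeffAt e (D ⊕ (+ t ⊝ + h)) ts hs es j
coeffAt-suc p D t ts h hs e es zero =
  cong (λ z → if not (at false es 0 xor e) then (at 0 ts 0 ∸ 1) C (at 0 hs 0 ∸ 1) else binomℤ (at 0 ts 0 ∸ 1) z)
       (deficit-+ D t h (sum (take 1 ts)) (sum (take 1 hs)))
coeffAt-suc p D t ts h hs e es (suc j) =
  cong (λ z → if not (at false es (suc j) xor at false es j) then (at 0 ts (suc j) ∸ 1) C (at 0 hs (suc j) ∸ 1) else binomℤ (at 0 ts (suc j) ∸ 1) z)
       (deficit-+ D t h (sum (take (suc (suc j)) ts)) (sum (take (suc (suc j)) hs)))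

product-coeffAt : ∀ n p D ts hs es → length ts ≡ n → length hs ≡ n → length es ≡ n → product (map (coeffAt p D ts hs es) (upTo n)) ≡ coeffFrom p D ts hs es
product-coeffAt zero p D [] [] [] lt lh le = refl
product-coeffAt (suc n) p D (t ∷ ts) (h ∷ hs) (e ∷ es) lt lh le =
  cong₂ N._*_ hd
    (trans (cong product (trans (LP.map-applyUpTo suc (coeffAt p D (t ∷ ts) (h ∷ hs) (e ∷ es)) n)
                         (trans (applyUpTo-cong n (λ i → coeffAt-suc p D t ts h hs e es i)) (sym (LP.map-applyUpTo id (coeffAt e (D ⊕ (+ t ⊝ + h)) ts hs es) n)))))
           (product-coeffAt n e (D ⊕ (+ t ⊝ + h)) ts hs es (NP.suc-injective lt) (NP.suc-injective lh) (NP.suc-injective le)))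
  where
  hd : coeffAt p D (t ∷ ts) (h ∷ hs) (e ∷ es) 0 ≡ (if not (e xor p) then (t ∸ 1) C (h ∸ 1) else binomℤ (t ∸ 1) (D ⊕ (+ t ⊝ + h)))
  hd = cong₂ (λ y z → if not (e xor p) then (t ∸ 1) C (h ∸ 1) else binomℤ (t ∸ 1) (D ⊕ (+ y ⊝ + z))) (NP.+-identityʳ t) (NP.+-identityʳ h)

product-cAt : ∀ n ts hs es → length ts ≡ n → length hs ≡ n → length es ≡ n → product (map (cAt ts hs es) (upTo n)) ≡ coeffFrom (at false es 0) (+ 0) ts hs es
product-cAt n ts hs es lt lh le = trans (cong product (LP.map-cong (cAt≡coeffAt ts hs es) (upTo n))) (product-coeffAt n (at false es 0) (+ 0) ts hs es lt lh le)

does-true : ∀ b → does (b ≟ᴮ true) ≡ b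
does-true true = refl
does-true false = refl

merge-zip : ∀ {X Y : Set} es (xs ys : List X) (xs' ys' : List Y) → length xs ≡ length xs' → length ys ≡ length ys' →
  map proj₁ (merge es (zip xs xs') (zip ys ys')) ≡ merge es xs ys × map proj₂ (merge es (zip xs xs') (zip ys ys')) ≡ merge es xs' ys'
merge-zip [] xs ys xs' ys' l1 l2 = refl , refl
merge-zip (true ∷ es) [] ys [] ys' l1 l2 = refl , refl
merge-zip (true ∷ es) [] ys (_ ∷ _) ys' () l2
merge-zip (true ∷ es) (_ ∷ _) ys [] ys' () l2
merge-zip (true ∷ es) (y ∷ xs) ys (y' ∷ xs') ys' l1 l2 =
  let (e1 , e2) = merge-zip es xs ys xs' ys' (NP.suc-injective l1) l2 in cong (y ∷_) e1 , cong (y' ∷_) e2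
merge-zip (false ∷ es) xs [] xs' [] l1 l2 = refl , refl
merge-zip (false ∷ es) xs [] xs' (_ ∷ _) l1 ()
merge-zip (false ∷ es) xs (_ ∷ _) xs' [] l1 ()
merge-zip (false ∷ es) xs (y ∷ ys) xs' (y' ∷ ys') l1 l2 =
  let (e1 , e2) = merge-zip es xs ys xs' ys' l1 (NP.suc-injective l2) in cong (y ∷_) e1 , cong (y' ∷_) e2

toList-zip : ∀ {X Y : Set} {m} (xs : Vec X m) (ys : Vec Y m) → Vec.toList (Vec.zip xs ys) ≡ zip (Vec.toList xs) (Vec.toList ys)
toList-zip Vec.[] Vec.[] = refl
toList-zip (y Vec.∷ xs) (z Vec.∷ ys) = cong ((y , z) ∷_) (toList-zip xs ys)

-- The right-hand side of the statement

module StatementRhs {G : Set} {k ℓ : ℕ} (r : Vec ℕ k) (a : Vec G k) (s : Vec ℕ ℓ) (b : Vec G ℓ) (f : IWord G → ℤ) where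
  n N : ℕ
  n = k + ℓ
  N = Vec.sum r + Vec.sum s

  rL sL : List ℕ
  rL = Vec.toList r
  sL = Vec.toList s

  aL bL : List G
  aL = Vec.toList a
  bL = Vec.toList b

  u v : IWord G
  u = word r a
  v = word s b

  comps : List (Vec ℕ n)
  comps = compositions n N

  Pair : Set
  Pair = Vec (Fin n) k × Vec (Fin n) ℓ

  coeffᴺ : List ℕ → List ℕ → List ℕ → ℕ
  coeffᴺ ts Lφ Lψ = product (map (cAt ts (map (λ i → Mb.fromMaybe 0 (interleaveAtᴺ Lφ Lψ rL sL i)) (upTo n)) (map (memberᵇ Lφ) (upTo n))) (upTo n))

  pairTerm : List ℕ → List ℕ → ℤ
  pairTerm Lφ Lψ = ∑ comps (λ t → + coeffᴺ (Vec.toList t) Lφ Lψ ⊗ f (zip (Vec.toList t) (merge (membershipBits n Lφ) aL bL)) ⊕ + 0)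

  patternForm : ℤ
  patternForm = ∑ (patterns k ℓ) (patternValue N n N u v f)

  coeff-eq : ∀ t (φ : Vec (Fin n) k) (ψ : Vec (Fin n) ℓ) → coeff r s t φ ψ ≡ coeffᴺ (Vec.toList t) (toℕs φ) (toℕs ψ)
  coeff-eq t φ ψ = cong₂ (λ H E → product (map (cAt (Vec.toList t) H E) (upTo n)))
    (map-allFin n _ (λ i → Mb.fromMaybe 0 (interleaveAtᴺ (toℕs φ) (toℕs ψ) rL sL i)) (λ i → cong (Mb.fromMaybe 0) (interleaveAt≡interleaveAtᴺ φ ψ r s i)))
    (map-allFin n (inImage φ) (memberᵇ (toℕs φ)) (inImage≡memberᵇ φ))

  length-membershipBits : ∀ L → length (membershipBits n L) ≡ n
  length-membershipBits L = trans (LP.length-map (memberᵇ L) (upTo n)) (LP.length-applyUpTo id n)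

  interleave-valid : ∀ (φ : Vec (Fin n) k) (ψ : Vec (Fin n) ℓ) → validPairᵇ n (toℕs φ) (toℕs ψ) ≡ true → interleave φ ψ a b ≡ just (merge (membershipBits n (toℕs φ)) aL bL)
  interleave-valid φ ψ valid = begin
      sequenceMaybe (map (interleaveAt φ ψ a b) (allFin n))
    ≡⟨ cong sequenceMaybe (map-allFin n (interleaveAt φ ψ a b) (interleaveAtᴺ (toℕs φ) (toℕs ψ) aL bL) (interleaveAt≡interleaveAtᴺ φ ψ a b)) ⟩
      sequenceMaybe (map (interleaveAtᴺ (toℕs φ) (toℕs ψ) aL bL) (upTo n))
    ≡⟨ cong₂ (λ X Y → sequenceMaybe (map (interleaveAtᴺ X Y aL bL) (upTo n))) (sym (proj₁ positions)) (sym (proj₂ positions)) ⟩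
      sequenceMaybe (map (interleaveAtᴺ (truePositions 0 bits) (falsePositions 0 bits) aL bL) (upTo n))
    ≡⟨ cong (λ L → sequenceMaybe (map (interleaveAtᴺ (truePositions 0 bits) (falsePositions 0 bits) aL bL) L)) (trans (upTo≡interval n) (cong (interval 0) (sym (length-membershipBits (toℕs φ))))) ⟩
      sequenceMaybe (map (interleaveAtᴺ (truePositions 0 bits) (falsePositions 0 bits) aL bL) (interval 0 (length bits)))
    ≡⟨ cong sequenceMaybe (interleaveAtᴺ-positions 0 bits aL bL counts) ⟩
      sequenceMaybe (map just (merge bits aL bL))
    ≡⟨ sequenceMaybe-just (merge bits aL bL) ⟩
      just (merge bits aL bL)
    ∎
    where
    open ≡-Reasoning
    bits = membershipBits n (toℕs φ)
    positions = validPair-positions n (toℕs φ) (toℕs ψ) valid (toℕs-bounded φ) (toℕs-bounded ψ)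
    counts : Counts bits (length aL) (length bL)
    counts = subst₂ (Counts bits) (sym (VP.length-toList a)) (sym (VP.length-toList b))
             (Counts-membershipBits n k ℓ (toℕs φ) (toℕs ψ) valid (toℕs-bounded φ) (toℕs-bounded ψ) (length-toℕs φ) (length-toℕs ψ))


  merge-word : ∀ es → map proj₁ (merge es u v) ≡ merge es rL sL × map proj₂ (merge es u v) ≡ merge es aL bL
  merge-word es rewrite toList-zip r a | toList-zip s b = merge-zip es rL sL aL bL (trans (VP.length-toList r) (sym (VP.length-toList a))) (trans (VP.length-toList s) (sym (VP.length-toList b)))

  pairTerm-pattern : ∀ es → Counts es k ℓ → pairTerm (truePositions 0 es) (falsePositions 0 es) ≡ patternValue N n N u v f es
  pairTerm-pattern es ce = trans (∑-compositions n N _) (∑-congᴬ (All-tuples (map suc (upTo N)) n (All-positiveRange N)) (λ t (lt , _) →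
      cong (when (sum t ≡ᵇ N)) (trans (ZP.+-identityʳ _)
        (cong₂ (λ c w → + c ⊗ f (zip t w)) (trans (coeff-pattern t lt) (cong (λ h → coeffFrom (at false es 0) (+ 0) t h es) (sym (proj₁ (merge-word es)))))
               (trans (cong (λ e → merge e aL bL) (membershipBits∘truePositions n es (Counts-length ce))) (sym (proj₂ (merge-word es))))))))
    where
    countsR : Counts es (length rL) (length sL)
    countsR = subst₂ (Counts es) (sym (VP.length-toList r)) (sym (VP.length-toList s)) ce
    heights-pattern : map (λ i → Mb.fromMaybe 0 (interleaveAtᴺ (truePositions 0 es) (falsePositions 0 es) rL sL i)) (upTo n) ≡ merge es rL sL
    heights-pattern = begin
        map (λ i → Mb.fromMaybe 0 (interleaveAtᴺ (truePositions 0 es) (falsePositions 0 es) rL sL i)) (upTo n)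
      ≡⟨ LP.map-∘ (upTo n) ⟩
        map (Mb.fromMaybe 0) (map (interleaveAtᴺ (truePositions 0 es) (falsePositions 0 es) rL sL) (upTo n))
      ≡⟨ cong (λ L → map (Mb.fromMaybe 0) (map (interleaveAtᴺ (truePositions 0 es) (falsePositions 0 es) rL sL) L)) (trans (upTo≡interval n) (cong (interval 0) (sym (Counts-length ce)))) ⟩
        map (Mb.fromMaybe 0) (map (interleaveAtᴺ (truePositions 0 es) (falsePositions 0 es) rL sL) (interval 0 (length es)))
      ≡⟨ cong (map (Mb.fromMaybe 0)) (interleaveAtᴺ-positions 0 es rL sL countsR) ⟩
        map (Mb.fromMaybe 0) (map just (merge es rL sL))
      ≡⟨ trans (sym (LP.map-∘ (merge es rL sL))) (LP.map-id (merge es rL sL)) ⟩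
        merge es rL sL
      ∎
      where open ≡-Reasoning
    coeff-pattern : ∀ t → length t ≡ n → coeffᴺ t (truePositions 0 es) (falsePositions 0 es) ≡ coeffFrom (at false es 0) (+ 0) t (merge es rL sL) es
    coeff-pattern t lt = trans (cong₂ (λ H E → product (map (cAt t H E) (upTo n))) heights-pattern (membershipBits∘truePositions n es (Counts-length ce)))
                     (product-cAt n t (merge es rL sL) es lt (trans (length-merge es rL sL countsR) (Counts-length ce)) (Counts-length ce))

  allφ : List (Vec (Fin n) k)
  allφ = allVecs (allFin n) k

  allψ : List (Vec (Fin n) ℓ)
  allψ = allVecs (allFin n) ℓ

  ∑-I≡patternForm : ∑ (I k ℓ) (λ p → pairTerm (toℕs (proj₁ p)) (toℕs (proj₂ p))) ≡ patternForm
  ∑-I≡patternForm = begin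
      ∑ (I k ℓ) g
    ≡⟨ ∑-filter (λ p → isShufflePair (proj₁ p) (proj₂ p) ≟ᴮ true) (concatMap (λ φ → map (φ ,_) allψ) allφ) g ⟩
      ∑ (concatMap (λ φ → map (φ ,_) allψ) allφ) (λ p → when (does (isShufflePair (proj₁ p) (proj₂ p) ≟ᴮ true)) (g p))
    ≡⟨ ∑-concatMap (λ φ → map (φ ,_) allψ) allφ _ ⟩
      ∑ allφ (λ φ → ∑ (map (φ ,_) allψ) (λ p → when (does (isShufflePair (proj₁ p) (proj₂ p) ≟ᴮ true)) (g p)))
    ≡⟨ ∑-cong allφ (λ φ → trans (∑-map (φ ,_) allψ _) (∑-cong allψ (λ ψ → cong (λ z → when z (pairTerm (toℕs φ) (toℕs ψ))) (trans (does-true _) (isShufflePair≡validPairᵇ φ ψ))))) ⟩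
      ∑ allφ (λ φ → ∑ allψ (λ ψ → when (validPairᵇ n (toℕs φ) (toℕs ψ)) (pairTerm (toℕs φ) (toℕs ψ))))
    ≡⟨ ∑-cong allφ (λ φ → trans (∑-allVecs-map (allFin n) toℕ ℓ (λ Lψ → when (validPairᵇ n (toℕs φ) Lψ) (pairTerm (toℕs φ) Lψ)))
                                (cong (λ xs → ∑ (tuples xs ℓ) (λ Lψ → when (validPairᵇ n (toℕs φ) Lψ) (pairTerm (toℕs φ) Lψ))) (map-toℕ-allFin n))) ⟩
      ∑ allφ (λ φ → ∑ tuplesψ (λ Lψ → when (validPairᵇ n (toℕs φ) Lψ) (pairTerm (toℕs φ) Lψ)))
    ≡⟨ trans (∑-allVecs-map (allFin n) toℕ k (λ Lφ → ∑ tuplesψ (λ Lψ → when (validPairᵇ n Lφ Lψ) (pairTerm Lφ Lψ))))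
             (cong (λ xs → ∑ (tuples xs k) (λ Lφ → ∑ tuplesψ (λ Lψ → when (validPairᵇ n Lφ Lψ) (pairTerm Lφ Lψ)))) (map-toℕ-allFin n)) ⟩
      ∑ (tuples (upTo n) k) (λ Lφ → ∑ tuplesψ (λ Lψ → when (validPairᵇ n Lφ Lψ) (pairTerm Lφ Lψ)))
    ≡⟨ ∑-validPairs≡∑-patterns k ℓ pairTerm ⟩
      ∑ (patterns k ℓ) (λ es → pairTerm (truePositions 0 es) (falsePositions 0 es))
    ≡⟨ ∑-congᴬ (All-patterns k ℓ) pairTerm-pattern ⟩
      patternForm
    ∎
    where
    open ≡-Reasoning
    tuplesψ = tuples (upTo n) ℓ
    g : Pair → ℤ
    g p = pairTerm (toℕs (proj₁ p)) (toℕs (proj₂ p))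

  rhs-eval-via : (T : Vec (Fin n) k → Vec (Fin n) ℓ → Vec ℕ n → Maybe (List G) → FreeAb (IWord G)) →
    (∀ φ ψ t ab → T φ ψ t (just ab) ≡ (+ coeff r s t φ ψ , zip (Vec.toList t) ab) ∷ []) →
    (H : Pair → FreeAb (IWord G)) → (∀ φ ψ → H (φ , ψ) ≡ concatMap (λ t → T φ ψ t (interleave φ ψ a b)) comps) →
    evalLin f (concatMap H (I k ℓ)) ≡ patternForm
  rhs-eval-via T hT H hH = trans (evalLin-concatMap f H (I k ℓ))
      (trans (∑-congᴬ (AllP.all-filter (λ p → isShufflePair (proj₁ p) (proj₂ p) ≟ᴮ true) (concatMap (λ φ → map (φ ,_) allψ) allφ)) term-valid) ∑-I≡patternForm)
    where
    term-valid : ∀ p → isShufflePair (proj₁ p) (proj₂ p) ≡ true → evalLin f (H p) ≡ pairTerm (toℕs (proj₁ p)) (toℕs (proj₂ p))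
    term-valid (φ , ψ) vp = begin
        evalLin f (H (φ , ψ))
      ≡⟨ cong (evalLin f) (hH φ ψ) ⟩
        evalLin f (concatMap (λ t → T φ ψ t (interleave φ ψ a b)) comps)
      ≡⟨ cong (λ m → evalLin f (concatMap (λ t → T φ ψ t m) comps)) (interleave-valid φ ψ (trans (sym (isShufflePair≡validPairᵇ φ ψ)) vp)) ⟩
        evalLin f (concatMap (λ t → T φ ψ t (just abm)) comps)
      ≡⟨ evalLin-concatMap f (λ t → T φ ψ t (just abm)) comps ⟩
        ∑ comps (λ t → evalLin f (T φ ψ t (just abm)))
      ≡⟨ ∑-cong comps (λ t → trans (cong (evalLin f) (hT φ ψ t abm)) (cong (λ c → + c ⊗ f (zip (Vec.toList t) abm) ⊕ + 0) (coeff-eq t φ ψ))) ⟩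
        pairTerm (toℕs φ) (toℕs ψ)
      ∎
      where
      open ≡-Reasoning
      abm = merge (membershipBits n (toℕs φ)) aL bL

  rhs-eval-via-head : (T : Vec (Fin n) k → Vec (Fin n) ℓ → Vec ℕ n → Maybe (List G) → FreeAb (IWord G)) →
    (∀ φ ψ t ab → T φ ψ t (just ab) ≡ (+ coeff r s t φ ψ , zip (Vec.toList t) ab) ∷ []) →
    (H : Pair → FreeAb (IWord G)) → (∀ φ ψ → H (φ , ψ) ≡ concatMap (λ t → T φ ψ t (interleave φ ψ a b)) comps) →
    (φ0 : Vec (Fin n) k) (ψ0 : Vec (Fin n) ℓ) (m0 : Maybe (List G)) (L : List Pair) →
    interleave φ0 ψ0 a b ≡ m0 → I k ℓ ≡ (φ0 , ψ0) ∷ L →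
    evalLin f (concatMap (λ t → T φ0 ψ0 t m0) comps ++ concatMap H L) ≡ patternForm
  rhs-eval-via-head T hT H hH φ0 ψ0 m0 L eqm eqI =
    trans (cong (λ X → evalLin f (X ++ concatMap H L)) (sym (trans (hH φ0 ψ0) (cong (λ m → concatMap (λ t → T φ0 ψ0 t m) comps) eqm))))
      (trans (cong (λ L' → evalLin f (concatMap H L')) (sym eqI)) (rhs-eval-via T hT H hH))

  -- rhs uses a helper bound in a where block, which can only be reached by unification:
  -- splitting on I k ℓ and on the first interleaving lets Agda solve for it.
  rhs-eval : evalLin f (rhs r a s b) ≡ patternForm
  rhs-eval with I k ℓ in eqI
  ... | [] = trans (sym (cong (λ L → ∑ L (λ p → pairTerm (toℕs (proj₁ p)) (toℕs (proj₂ p)))) eqI)) ∑-I≡patternForm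
  ... | (φ0 , ψ0) ∷ L with interleave φ0 ψ0 a b in eqm
  ... | m0 = rhs-eval-via-head _ (λ _ _ _ _ → refl) _ (λ _ _ → refl) φ0 ψ0 m0 L eqm eqI

module _ {G : Set} where
  evalLin-⧢ρ-basis : ∀ (u v : List (ℕ × G)) f → evalLin f (basis u ⧢ρ basis v) ≡ lhsValue u v f
  evalLin-⧢ρ-basis u v f = begin
      evalLin f ((units ++ []) ++ [])
    ≡⟨ cong (evalLin f) (trans (LP.++-identityʳ _) (LP.++-identityʳ units)) ⟩
      evalLin f units
    ≡⟨ evalLin-unit (ρ⁻¹ u ⧢ ρ⁻¹ v) ⟩
      lhsValue u v f
    ∎
    where
    open ≡-Reasoning
    units = map (λ w → (+ 1 ⊗ + 1 , ρ w)) (ρ⁻¹ u ⧢ ρ⁻¹ v)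
    evalLin-unit : ∀ W → evalLin f (map (λ w → (+ 1 ⊗ + 1 , ρ w)) W) ≡ ∑ W (f ∘ ρ)
    evalLin-unit [] = refl
    evalLin-unit (w ∷ W) = cong₂ _⊕_ (ZP.*-identityˡ (f (ρ w))) (evalLin-unit W)

  positive-word : ∀ {m} (r : Vec ℕ m) (a : Vec G m) → All (1 ≤_) r → Positive (word r a)
  positive-word Vec.[] Vec.[] VAll.[] = []
  positive-word (y Vec.∷ r) (z Vec.∷ a) (p VAll.∷ pr) = p ∷ positive-word r a pr

  weight-word : ∀ {m} (r : Vec ℕ m) (a : Vec G m) → weight (word r a) ≡ Vec.sum r
  weight-word Vec.[] Vec.[] = refl
  weight-word (y Vec.∷ r) (z Vec.∷ a) = cong (λ w → y + w) (weight-word r a)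

theorem2p1 : (G : Set) (k ℓ : ℕ) → 1 ≤ k → 1 ≤ ℓ →
    (r : Vec ℕ k) → All (1 ≤_) r → (a : Vec G k) →
    (s : Vec ℕ ℓ) → All (1 ≤_) s → (b : Vec G ℓ) →
    (basis (word r a) ⧢ρ basis (word s b)) ≈ rhs r a s b
theorem2p1 G k ℓ _ _ r pr a s ps b f = begin
    evalLin f (basis u ⧢ρ basis v)
  ≡⟨ evalLin-⧢ρ-basis u v f ⟩
    lhsValue u v f
  ≡⟨ lhs≡rhs _ u v NP.≤-refl (positive-word r a pr) (positive-word s b ps) f (weight u + weight v) NP.≤-refl ⟩
    rhsValue (length u) (length v) u v f (weight u + weight v)
  ≡⟨ cong₂ (λ k' ℓ' → rhsValue k' ℓ' u v f (weight u + weight v)) (VP.length-toList (Vec.zip r a)) (VP.length-toList (Vec.zip s b)) ⟩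
    rhsValue k ℓ u v f (weight u + weight v)
  ≡⟨ cong (λ W → ∑ (patterns k ℓ) (patternValue W (k + ℓ) W u v f)) (cong₂ _+_ (weight-word r a) (weight-word s b)) ⟩
    StatementRhs.patternForm r a s b f
  ≡⟨ sym (StatementRhs.rhs-eval r a s b f) ⟩
    evalLin f (rhs r a s b)
  ∎
  where
  open ≡-Reasoning
  u = word r a
  v = word s b
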